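{- Let $p$ be an odd prime, $z\in\mathbb{F}_p$, and let $t\in\mathbb{F}$ be a root of $\overline\gamma_z(X)$. Then $(t^p-t)^{p-1}=t^{p^2}$. In particular $(t^p-t)^{p-1}$ is also a root of $\overline\gamma_z(X)$.
   Context: $\mathbb{F}$ is an algebraic closure of $\mathbb{F}_p$. For $z\in\mathbb{F}_p$, $\gamma_z(X):=X^{p+1}+(1+z)X^p+X+1\in\mathbb{F}_p[X]$, and $\overline\gamma_z(X):=1$ if $z=0$; $\overline\gamma_z(X):=\gamma_z(X)/(X-1)$ if $z=-4$; $\overline\gamma_z(X):=\gamma_z(X)/(X^2+(z+2)X+1)$ if $z\ne0,-4$ and $z^2+4z$ is a square in $\mathbb{F}_p$; $\overline\gamma_z(X):=\gamma_z(X)$ if $z^2+4z$ is a non-square in $\mathbb{F}_p$. (The quantity $(t^p-t)^{p-1}$ is the value at $(t,1)$ of Dickson's invariant $I_0=[1,2]/[0,1]$, where $[i,j]=x^{p^i}y^{p^j}-x^{p^j}y^{p^i}$.) -}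

module Defs where

open import Level using (Level)
open import Data.Nat using (ℕ; zero; suc; _+_; _*_; _∸_; _≤?_; _<_; _≟_; NonZero)
open import Data.Nat.DivMod using (_%_)
open import Data.List using (List; []; _∷_; length; map; foldl; replicate; upTo; _++_)
open import Data.List.Relation.Unary.Any using (Any; any?)
open import Data.Product using (Σ; ∃; _,_)
open import Relation.Nullary using (¬_; yes; no; Dec)
open import Relation.Binary.PropositionalEquality using (_≡_)
open import Algebra.Bundles using (CommutativeRing; Semiring)
import Algebra.Definitions.RawSemiring as RS

-- Polynomials over F_p are lists of natural numbers (read modulo p),
-- listed from the HIGHEST degree coefficient down to the constant term.

subₚ : (p : ℕ) .{{_ : NonZero p}} → ℕ → ℕ → ℕ
subₚ p a b = (a + (p ∸ (b % p))) % p

subFront : (p : ℕ) .{{_ : NonZero p}} → List ℕ → List ℕ → List ℕ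
subFront p (a ∷ as) (b ∷ bs) = subₚ p a b ∷ subFront p as bs
subFront p as       []       = as
subFront p []       (_ ∷ _)  = []

-- quotient of long division of f by the MONIC polynomial 1·X^m + ds
-- (fuel = length f suffices)
quotMonicF : (p : ℕ) .{{_ : NonZero p}} → ℕ → List ℕ → List ℕ → List ℕ
quotMonicF p zero     ds f        = []
quotMonicF p (suc n)  ds []       = []
quotMonicF p (suc n)  ds (c ∷ f) with length ds ≤? length f
... | yes _ = (c % p) ∷ quotMonicF p n ds (subFront p f (map (λ d → c * d) ds))
... | no  _ = []

quotMonic : (p : ℕ) .{{_ : NonZero p}} → List ℕ → List ℕ → List ℕ
quotMonic p ds f = quotMonicF p (length f) ds f

-- γ_z(X) = X^{p+1} + (1+z) X^p + X + 1
γ : (p : ℕ) .{{_ : NonZero p}} → ℕ → List ℕ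
γ p z = 1 ∷ ((1 + z) % p) ∷ (replicate (p ∸ 2) 0 ++ (1 ∷ 1 ∷ []))

IsSquareₚ : (p : ℕ) .{{_ : NonZero p}} → ℕ → Set
IsSquareₚ p a = Any (λ w → (w * w) % p ≡ a % p) (upTo p)

isSquareₚ? : (p : ℕ) .{{_ : NonZero p}} → (a : ℕ) → Dec (IsSquareₚ p a)
isSquareₚ? p a = any? (λ w → ((w * w) % p) ≟ (a % p)) (upTo p)

γbar : (p : ℕ) .{{_ : NonZero p}} → ℕ → List ℕ
γbar p z with (z % p) ≟ 0
... | yes _ = 1 ∷ []
... | no  _ with ((z + 4) % p) ≟ 0
...   | yes _ = quotMonic p ((p ∸ 1) ∷ []) (γ p z)                 -- divide by X - 1
...   | no  _ with isSquareₚ? p (z * z + 4 * z)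
...     | yes _ = quotMonic p (((z + 2) % p) ∷ 1 ∷ []) (γ p z)      -- divide by X^2+(z+2)X+1
...     | no  _ = γ p z

module _ {c ℓ : Level} (K : CommutativeRing c ℓ) where
  open CommutativeRing K using (Carrier; _≈_; 0#; 1#; semiring) renaming (_+_ to _+ᴷ_; _*_ to _*ᴷ_)
  open RS (Semiring.rawSemiring semiring) using () renaming (_×_ to _·ℕ_)

  ι : ℕ → Carrier
  ι n = n ·ℕ 1#

  evalₚ : List ℕ → Carrier → Carrier
  evalₚ f x = foldl (λ acc a → acc *ᴷ x +ᴷ ι a) 0# f

  evalK : List Carrier → Carrier → Carrier
  evalK f x = foldl (λ acc a → acc *ᴷ x +ᴷ a) 0# f

  record IsAlgClosureOfFₚ (p : ℕ) : Set (c Level.⊔ ℓ) where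
    field
      nontrivial     : ¬ (1# ≈ 0#)
      inverses       : ∀ x → ¬ (x ≈ 0#) → ∃ λ y → x *ᴷ y ≈ 1#
      characteristic : ι p ≈ 0#
      algClosed      : ∀ (a : Carrier) (cs : List Carrier) →
                         ∃ λ x → evalK (1# ∷ a ∷ cs) x ≈ 0#
      algebraic      : ∀ x → ∃ λ (cs : List ℕ) → evalₚ (1 ∷ cs) x ≈ 0#

{-# OPTIONS --safe #-}

-- Write u = t ^ p and v = t ^ p².  As γ_z has coefficients in 𝔽ₚ, γ_z(u) = γ_z(t) ^ p = 0, and
--   (u + 1 + z) (v (u − t − 1) + u) = γ_z(t) + (u − t − 1) γ_z(u) = 0.
-- The first factor is nonzero (otherwise γ_z(u) = 0 forces u = −1 and then z = 0), hence
-- (u − t) v = v − u = (u − t) ^ p, and cancelling u − t ≠ 0 gives (t ^ p − t) ^ (p − 1) = t ^ p².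
--
-- So it suffices that a root t of γ̄_z is a root of γ_z outside 𝔽ₚ, with z ≠ 0.  On 𝔽ₚ, γ_z agrees
-- with X² + (z + 2) X + 1; this makes the divisors removed in γ̄_z vanish wherever γ_z does on 𝔽ₚ,
-- so the division remainders are zero and t is a root of γ_z.  A root t ∈ 𝔽ₚ of γ̄_z would be a
-- double root of γ_z, but γ_z′ = X ^ p + 1 (computed with dual numbers) forces t = −1, which is
-- not a root of the divisor.  If z² + 4z is not a square, t ∈ 𝔽ₚ would make (2t + z + 2)² = z² + 4z
-- a square, 𝔽ₚ being the set of roots of X ^ p − X.  Finally t ^ p² is a root of γ̄_z by Frobenius.

module Submission where

open import Level using (Level; _⊔_)
open import Algebra.Bundles using (CommutativeRing; Semiring)
open import Algebra.Structures using (IsCommutativeRing)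
open import Algebra.Morphism.Structures using (module SemiringMorphisms)
open import Algebra.Solver.Ring.AlmostCommutativeRing using (fromCommutativeRing; _-Raw-AlmostCommutative⟶_)
import Algebra.Solver.Ring
import Algebra.Definitions.RawSemiring as RS
open import Data.Nat as ℕ using (ℕ; zero; suc; _<_; _≤_; _≤?_; _∸_; s≤s; z≤n; NonZero; nonTrivial⇒n>1)
import Data.Nat.Properties as ℕₚ
open import Data.Nat.Combinatorics using (_C_; nC1≡n; nCn≡1; nCk+nC[k+1]≡[n+1]C[k+1])
open import Data.Nat.Divisibility using (_∣_; divides; ∣⇒≤; m%n≡0⇒n∣m)
open import Data.Nat.DivMod using (_%_; _/_; m≡m%n+[m/n]*n; m%n<n; m<n⇒m%n≡m)
open import Data.Nat.Primality using (Prime; euclidsLemma; prime⇒nonTrivial)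
open import Data.Nat.Coprimality using (prime⇒coprime; coprime-Bézout)
open import Data.Nat.GCD using (module Bézout)
open import Data.Integer as ℤ using (ℤ; +_; -[1+_]; _⊖_)
import Data.Integer.Properties as ℤₚ
open import Data.Fin as Fin using (Fin)
import Data.Fin.Properties as Finₚ
open import Data.Vec as Vec using (Vec; []; _∷_)
open import Data.Vec.Functional using (tail; init; last)
open import Data.List using (List; []; _∷_; length; map; foldl; replicate; _++_)
import Data.List.Properties as Listₚ
open import Data.List.Relation.Unary.All using (All; []; _∷_)
open import Data.List.Relation.Unary.Any using (satisfied)
open import Data.List.Membership.Propositional using (lose)
open import Data.List.Membership.Propositional.Properties using (∈-upTo⁺)
open import Data.Maybe using (Maybe; just; nothing)
open import Data.Product using (∃; _×_; _,_; proj₁; proj₂)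
open import Data.Sum using (inj₁; inj₂)
open import Data.Empty using (⊥; ⊥-elim)
open import Function.Definitions using (Injective)
open import Relation.Nullary using (¬_; yes; no)
open import Relation.Binary.Definitions using (tri<; tri≈; tri>)
open import Relation.Binary.PropositionalEquality as ≡ using (_≡_)
open import Defs
  using (evalₚ; subₚ; subFront; quotMonicF; quotMonic; γ; γbar; IsSquareₚ; isSquareₚ?; IsAlgClosureOfFₚ; module IsAlgClosureOfFₚ)

[1+k]*[1+n]C[1+k]≡[1+n]*nCk : ∀ n k → suc k ℕ.* (suc n C suc k) ≡ suc n ℕ.* (n C k)
[1+k]*[1+n]C[1+k]≡[1+n]*nCk zero    zero    = ≡.refl
[1+k]*[1+n]C[1+k]≡[1+n]*nCk zero    (suc k) = ℕₚ.*-zeroʳ (suc (suc k))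
[1+k]*[1+n]C[1+k]≡[1+n]*nCk (suc n) zero    = begin
  1 ℕ.* (suc (suc n) C 1) ≡⟨ ℕₚ.*-identityˡ _ ⟩
  suc (suc n) C 1         ≡⟨ nC1≡n (suc (suc n)) ⟩
  suc (suc n)             ≡⟨ ℕₚ.*-identityʳ _ ⟨
  suc (suc n) ℕ.* 1       ∎
  where open ≡.≡-Reasoning
[1+k]*[1+n]C[1+k]≡[1+n]*nCk (suc n) (suc k) = begin
  suc (suc k) ℕ.* (suc (suc n) C suc (suc k))
    ≡⟨ ≡.cong (suc (suc k) ℕ.*_) (nCk+nC[k+1]≡[n+1]C[k+1] (suc n) (suc k)) ⟨
  suc (suc k) ℕ.* (A ℕ.+ B)
    ≡⟨ ℕₚ.*-distribˡ-+ (suc (suc k)) A B ⟩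
  A ℕ.+ suc k ℕ.* A ℕ.+ suc (suc k) ℕ.* B
    ≡⟨ ≡.cong₂ (λ x y → A ℕ.+ x ℕ.+ y) ([1+k]*[1+n]C[1+k]≡[1+n]*nCk n k)
                                        ([1+k]*[1+n]C[1+k]≡[1+n]*nCk n (suc k)) ⟩
  A ℕ.+ suc n ℕ.* (n C k) ℕ.+ suc n ℕ.* (n C suc k)
    ≡⟨ ℕₚ.+-assoc A _ _ ⟩
  A ℕ.+ (suc n ℕ.* (n C k) ℕ.+ suc n ℕ.* (n C suc k))
    ≡⟨ ≡.cong (A ℕ.+_) (ℕₚ.*-distribˡ-+ (suc n) (n C k) (n C suc k)) ⟨
  A ℕ.+ suc n ℕ.* (n C k ℕ.+ n C suc k)
    ≡⟨ ≡.cong (λ x → A ℕ.+ suc n ℕ.* x) (nCk+nC[k+1]≡[n+1]C[k+1] n k) ⟩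
  A ℕ.+ suc n ℕ.* A ∎
  where
  open ≡.≡-Reasoning
  A = suc n C suc k
  B = suc n C suc (suc k)

prime∣pCk : ∀ {p k} → Prime p → 0 < k → k < p → p ∣ p C k
prime∣pCk {suc n} {suc k} p-prime _ k<p
  with euclidsLemma (suc k) (suc n C suc k) p-prime
         (divides (n C k) (≡.trans ([1+k]*[1+n]C[1+k]≡[1+n]*nCk n k) (ℕₚ.*-comm (suc n) (n C k))))
... | inj₂ p∣pCk = p∣pCk
... | inj₁ p∣1+k = ⊥-elim (ℕₚ.<-irrefl ≡.refl (ℕₚ.<-≤-trans k<p (∣⇒≤ p∣1+k)))

module IntegerCoefficients {c ℓ} (R : CommutativeRing c ℓ) where
  open CommutativeRing R
  open import Relation.Binary.Reasoning.Setoid setoid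
  open import Algebra.Properties.Ring ring using (-‿involutive; -‿distribˡ-*; -‿distribʳ-*; -0#≈0#; -‿+-comm)
  open import Algebra.Properties.CommutativeSemigroup +-commutativeSemigroup using (interchange)
  open import Algebra.Properties.Monoid.Mult +-monoid using (×-homo-+)
  open import Algebra.Properties.Semiring.Mult semiring using (×1-homo-*)

  ι : ℕ → Carrier
  ι = Defs.ι R

  ι-+ : ∀ m n → ι (m ℕ.+ n) ≈ ι m + ι n
  ι-+ = ×-homo-+ 1#

  ι-* : ∀ m n → ι (m ℕ.* n) ≈ ι m * ι n
  ι-* = ×1-homo-*

  -- Unlike ι, fromℕ has no trailing + 0#, so the solver's constants con (+ n) are literally
  -- 1#, 1# + 1#, … and solved identities can be stated with them.
  fromℕ : ℕ → Carrier
  fromℕ zero          = 0#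
  fromℕ (suc zero)    = 1#
  fromℕ (suc (suc n)) = 1# + fromℕ (suc n)

  fromℕ≈ι : ∀ n → fromℕ n ≈ ι n
  fromℕ≈ι zero          = refl
  fromℕ≈ι (suc zero)    = sym (+-identityʳ 1#)
  fromℕ≈ι (suc (suc n)) = +-congˡ (fromℕ≈ι (suc n))

  fromℤ : ℤ → Carrier
  fromℤ (+ n)     = fromℕ n
  fromℤ -[1+ n ] = - fromℕ (suc n)

  fromℤ-neg : ∀ i → fromℤ (ℤ.- i) ≈ - fromℤ i
  fromℤ-neg (+ zero)   = sym -0#≈0#
  fromℤ-neg (+ suc n)  = refl
  fromℤ-neg -[1+ n ]  = sym (-‿involutive _)

  fromℤ-⊖ : ∀ m n → fromℤ (m ⊖ n) ≈ ι m - ι n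
  fromℤ-⊖ m       zero    = sym (trans (+-congˡ -0#≈0#) (trans (+-identityʳ _) (sym (fromℕ≈ι m))))
  fromℤ-⊖ zero    (suc n) = trans (-‿cong (fromℕ≈ι (suc n))) (sym (+-identityˡ _))
  fromℤ-⊖ (suc m) (suc n) = begin
    fromℤ (suc m ⊖ suc n)      ≡⟨ ≡.cong fromℤ (ℤₚ.[1+m]⊖[1+n]≡m⊖n m n) ⟩
    fromℤ (m ⊖ n)              ≈⟨ fromℤ-⊖ m n ⟩
    ι m - ι n                  ≈⟨ +-identityˡ _ ⟨
    0# + (ι m - ι n)           ≈⟨ +-congʳ (-‿inverseʳ 1#) ⟨
    (1# - 1#) + (ι m - ι n)    ≈⟨ interchange 1# (- 1#) (ι m) (- ι n) ⟩
    (1# + ι m) + (- 1# - ι n)  ≈⟨ +-congˡ (-‿+-comm 1# (ι n)) ⟩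
    (1# + ι m) - (1# + ι n)    ∎

  fromℤ-+-homo : ∀ i j → fromℤ (i ℤ.+ j) ≈ fromℤ i + fromℤ j
  fromℤ-+-homo (+ m)     (+ n)     = begin
    fromℕ (m ℕ.+ n)   ≈⟨ fromℕ≈ι (m ℕ.+ n) ⟩
    ι (m ℕ.+ n)       ≈⟨ ι-+ m n ⟩
    ι m + ι n         ≈⟨ +-cong (fromℕ≈ι m) (fromℕ≈ι n) ⟨
    fromℕ m + fromℕ n ∎
  fromℤ-+-homo (+ m)     -[1+ n ]  =
    trans (fromℤ-⊖ m (suc n)) (+-cong (sym (fromℕ≈ι m)) (-‿cong (sym (fromℕ≈ι (suc n)))))
  fromℤ-+-homo -[1+ m ]  (+ n)     =
    trans (fromℤ-⊖ n (suc m)) (trans (+-comm _ _) (+-cong (-‿cong (sym (fromℕ≈ι (suc m)))) (sym (fromℕ≈ι n))))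
  fromℤ-+-homo -[1+ m ]  -[1+ n ]  = begin
    - fromℕ (suc (suc (m ℕ.+ n)))   ≈⟨ -‿cong (fromℕ≈ι (suc (suc (m ℕ.+ n)))) ⟩
    - ι (suc (suc (m ℕ.+ n)))       ≡⟨ ≡.cong (λ k → - ι (suc k)) (ℕₚ.+-suc m n) ⟨
    - ι (suc m ℕ.+ suc n)           ≈⟨ -‿cong (ι-+ (suc m) (suc n)) ⟩
    - (ι (suc m) + ι (suc n))       ≈⟨ -‿+-comm (ι (suc m)) (ι (suc n)) ⟨
    - ι (suc m) - ι (suc n)         ≈⟨ +-cong (-‿cong (fromℕ≈ι (suc m))) (-‿cong (fromℕ≈ι (suc n))) ⟨
    - fromℕ (suc m) - fromℕ (suc n) ∎

  fromℤ-*-homo-pos : ∀ m j → fromℤ (+ m ℤ.* j) ≈ fromℤ (+ m) * fromℤ j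
  fromℤ-*-homo-pos m (+ n) = begin
    fromℤ (+ m ℤ.* + n)   ≡⟨ ≡.cong fromℤ (ℤₚ.pos-* m n) ⟨
    fromℕ (m ℕ.* n)       ≈⟨ fromℕ≈ι (m ℕ.* n) ⟩
    ι (m ℕ.* n)           ≈⟨ ι-* m n ⟩
    ι m * ι n             ≈⟨ *-cong (fromℕ≈ι m) (fromℕ≈ι n) ⟨
    fromℕ m * fromℕ n     ∎
  fromℤ-*-homo-pos m -[1+ n ] = begin
    fromℤ (+ m ℤ.* -[1+ n ])        ≡⟨ ≡.cong fromℤ (ℤₚ.neg-distribʳ-* (+ m) (+ suc n)) ⟨
    fromℤ (ℤ.- (+ m ℤ.* + suc n))   ≈⟨ fromℤ-neg (+ m ℤ.* + suc n) ⟩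
    - fromℤ (+ m ℤ.* + suc n)       ≈⟨ -‿cong (fromℤ-*-homo-pos m (+ suc n)) ⟩
    - (fromℕ m * fromℕ (suc n))     ≈⟨ -‿distribʳ-* (fromℕ m) (fromℕ (suc n)) ⟩
    fromℕ m * - fromℕ (suc n)       ∎

  fromℤ-*-homo : ∀ i j → fromℤ (i ℤ.* j) ≈ fromℤ i * fromℤ j
  fromℤ-*-homo (+ m)    j = fromℤ-*-homo-pos m j
  fromℤ-*-homo -[1+ m ] j = begin
    fromℤ (-[1+ m ] ℤ.* j)          ≡⟨ ≡.cong fromℤ (ℤₚ.neg-distribˡ-* (+ suc m) j) ⟨
    fromℤ (ℤ.- (+ suc m ℤ.* j))     ≈⟨ fromℤ-neg (+ suc m ℤ.* j) ⟩
    - fromℤ (+ suc m ℤ.* j)         ≈⟨ -‿cong (fromℤ-*-homo-pos (suc m) j) ⟩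
    - (fromℕ (suc m) * fromℤ j)     ≈⟨ -‿distribˡ-* (fromℕ (suc m)) (fromℤ j) ⟩
    - fromℕ (suc m) * fromℤ j       ∎

  fromℤ-homomorphism : ℤ.+-*-rawRing -Raw-AlmostCommutative⟶ fromCommutativeRing R
  fromℤ-homomorphism = record
    { ⟦_⟧    = fromℤ
    ; +-homo = fromℤ-+-homo
    ; *-homo = fromℤ-*-homo
    ; -‿homo = fromℤ-neg
    ; 0-homo = refl
    ; 1-homo = refl
    }

  fromℤ-≟ : ∀ i j → Maybe (fromℤ i ≈ fromℤ j)
  fromℤ-≟ i j with i ℤ.≟ j
  ... | yes ≡.refl = just refl
  ... | no  _      = nothing

  open Algebra.Solver.Ring ℤ.+-*-rawRing (fromCommutativeRing R) fromℤ-homomorphism fromℤ-≟ public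
    using (solve; _:=_; _:+_; _:*_; :-_; _:-_; con)

module Frobenius {c ℓ} (R : CommutativeRing c ℓ) where
  open CommutativeRing R
  open import Relation.Binary.Reasoning.Setoid setoid
  open IntegerCoefficients R using (ι; ι-*)
  open import Algebra.Properties.Semiring.Exp semiring using (_^_)
  open import Algebra.Properties.CommutativeSemiring.Binomial commutativeSemiring
    using (binomialTerm; binomial) renaming (theorem to binomialTheorem)
  open import Algebra.Properties.Monoid.Sum +-monoid using (sum; sum-init-last; sum-cong-≋; sum-replicate-zero)
  open import Algebra.Properties.Monoid.Mult +-monoid using (×-congʳ)
  open import Algebra.Properties.Semiring.Mult semiring using (×-assoc-*)
  open RS (Semiring.rawSemiring semiring) using () renaming (_×_ to _·_)

  module _ {p : ℕ} (char : ι p ≈ 0#) where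

    ·-multiple-of-char : ∀ m x → p ∣ m → m · x ≈ 0#
    ·-multiple-of-char m x (divides q ≡.refl) = begin
      (q ℕ.* p) · x          ≈⟨ ×-congʳ (q ℕ.* p) (*-identityˡ x) ⟨
      (q ℕ.* p) · (1# * x)   ≈⟨ ×-assoc-* (q ℕ.* p) 1# x ⟨
      ι (q ℕ.* p) * x        ≈⟨ *-congʳ (ι-* q p) ⟩
      (ι q * ι p) * x        ≈⟨ *-congʳ (*-congˡ char) ⟩
      (ι q * 0#) * x         ≈⟨ *-congʳ (zeroʳ _) ⟩
      0# * x                 ≈⟨ zeroˡ x ⟩
      0#                     ∎

  frobenius-+ : ∀ {p} → Prime p → ι p ≈ 0# → ∀ x y → (x + y) ^ p ≈ x ^ p + y ^ p
  frobenius-+ {suc q} p-prime char x y = begin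
    (x + y) ^ suc q                                   ≈⟨ binomialTheorem (suc q) x y ⟩
    sum f                                             ≈⟨ +-congˡ (sum-init-last (tail f)) ⟩
    f Fin.zero + (sum (init (tail f)) + last (tail f)) ≈⟨ +-cong first (+-cong middle final) ⟩
    y ^ suc q + (0# + x ^ suc q)                      ≈⟨ +-congˡ (+-identityˡ _) ⟩
    y ^ suc q + x ^ suc q                             ≈⟨ +-comm _ _ ⟩
    x ^ suc q + y ^ suc q                             ∎
    where
    f = binomialTerm x y (suc q)
    first : f Fin.zero ≈ y ^ suc q
    first = trans (+-identityʳ _) (*-identityˡ _)
    final : last (tail f) ≈ x ^ suc q
    final = begin
      (suc q C Fin.toℕ (Fin.suc (Fin.fromℕ q))) · binomial x y (suc q) (Fin.suc (Fin.fromℕ q))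
        ≡⟨ ≡.cong (λ k → (suc q C suc k) · ((x ^ suc k) * (y ^ (q ℕ.∸ k)))) (Finₚ.toℕ-fromℕ q) ⟩
      (suc q C suc q) · ((x ^ suc q) * (y ^ (q ℕ.∸ q)))
        ≡⟨ ≡.cong₂ (λ a b → a · ((x ^ suc q) * (y ^ b))) (nCn≡1 (suc q)) (ℕₚ.n∸n≡0 q) ⟩
      1 · ((x ^ suc q) * 1#)  ≈⟨ +-identityʳ _ ⟩
      (x ^ suc q) * 1#        ≈⟨ *-identityʳ _ ⟩
      x ^ suc q               ∎
    middle : sum (init (tail f)) ≈ 0#
    middle = trans (sum-cong-≋ vanish) (sum-replicate-zero q)
      where
      vanish : ∀ i → init (tail f) i ≈ 0#
      vanish i = ·-multiple-of-char char _ _ (prime∣pCk p-prime (s≤s z≤n)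
        (s≤s (≡.subst (_< q) (≡.sym (Finₚ.toℕ-inject₁ i)) (Finₚ.toℕ<n i))))

module Polynomials {c ℓ} (R : CommutativeRing c ℓ) where
  open CommutativeRing R
  open import Relation.Binary.Reasoning.Setoid setoid
  open IntegerCoefficients R
  open import Algebra.Properties.Semiring.Exp semiring using (_^_)

  horner : Carrier → Carrier → List ℕ → Carrier
  horner x = foldl (λ acc a → acc * x + ι a)

  horner-acc : ∀ x acc f → horner x acc f ≈ acc * x ^ length f + evalₚ R f x
  horner-acc x acc []      = sym (trans (+-identityʳ _) (*-identityʳ _))
  horner-acc x acc (c ∷ f) = begin
    horner x (acc * x + ι c) f
      ≈⟨ horner-acc x (acc * x + ι c) f ⟩
    (acc * x + ι c) * x ^ length f + evalₚ R f x
      ≈⟨ solve 5 (λ a x b y e → (a :* x :+ b) :* y :+ e := a :* (x :* y) :+ ((con (+ 0) :* x :+ b) :* y :+ e))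
               refl acc x (ι c) (x ^ length f) (evalₚ R f x) ⟩
    acc * (x * x ^ length f) + ((0# * x + ι c) * x ^ length f + evalₚ R f x)
                                                   ≈⟨ +-congˡ (horner-acc x (0# * x + ι c) f) ⟨
    acc * x ^ length (c ∷ f) + evalₚ R (c ∷ f) x ∎

  evalMonicₚ : List ℕ → Carrier → Carrier
  evalMonicₚ ds x = x ^ length ds + evalₚ R ds x

  evalₚ-∷ : ∀ a f x → evalₚ R (a ∷ f) x ≈ ι a * x ^ length f + evalₚ R f x
  evalₚ-∷ a f x =
    trans (horner-acc x (0# * x + ι a) f) (+-congʳ (*-congʳ (trans (+-congʳ (zeroˡ x)) (+-identityˡ _))))

  evalₚ-[_] : ∀ a x → evalₚ R (a ∷ []) x ≈ ι a
  evalₚ-[ a ] x = trans (evalₚ-∷ a [] x) (trans (+-identityʳ _) (*-identityʳ _))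

  evalₚ-cong : ∀ f {x y} → x ≈ y → evalₚ R f x ≈ evalₚ R f y
  evalₚ-cong f {x} {y} x≈y = go f refl
    where
    go : ∀ f {a b} → a ≈ b → horner x a f ≈ horner y b f
    go []      a≈b = a≈b
    go (c ∷ f) a≈b = go f (+-congʳ (*-cong a≈b x≈y))

  evalₚ-zeros-++ : ∀ k f x → evalₚ R (replicate k 0 ++ f) x ≈ evalₚ R f x
  evalₚ-zeros-++ zero    f x = refl
  evalₚ-zeros-++ (suc k) f x = begin
    evalₚ R (0 ∷ replicate k 0 ++ f) x
      ≈⟨ evalₚ-∷ 0 (replicate k 0 ++ f) x ⟩
    0# * x ^ length (replicate k 0 ++ f) + evalₚ R (replicate k 0 ++ f) x
      ≈⟨ +-cong (zeroˡ _) (evalₚ-zeros-++ k f x) ⟩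
    0# + evalₚ R f x
      ≈⟨ +-identityˡ _ ⟩
    evalₚ R f x ∎

  evalₚ-map-* : ∀ c ds x → evalₚ R (map (λ d → c ℕ.* d) ds) x ≈ ι c * evalₚ R ds x
  evalₚ-map-* c []       x = sym (zeroʳ _)
  evalₚ-map-* c (d ∷ ds) x = begin
    evalₚ R (c ℕ.* d ∷ cds) x
      ≈⟨ evalₚ-∷ (c ℕ.* d) cds x ⟩
    ι (c ℕ.* d) * x ^ length cds + evalₚ R cds x
      ≡⟨ ≡.cong (λ n → ι (c ℕ.* d) * x ^ n + evalₚ R cds x) (Listₚ.length-map _ ds) ⟩
    ι (c ℕ.* d) * x ^ length ds + evalₚ R cds x
      ≈⟨ +-cong (*-congʳ (ι-* c d)) (evalₚ-map-* c ds x) ⟩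
    (ι c * ι d) * x ^ length ds + ι c * evalₚ R ds x
      ≈⟨ solve 4 (λ a b y e → (a :* b) :* y :+ a :* e := a :* (b :* y :+ e))
               refl (ι c) (ι d) (x ^ length ds) (evalₚ R ds x) ⟩
    ι c * (ι d * x ^ length ds + evalₚ R ds x)
      ≈⟨ *-congˡ (evalₚ-∷ d ds x) ⟨
    ι c * evalₚ R (d ∷ ds) x ∎
    where cds = map (λ d → c ℕ.* d) ds

module _ {c₁ ℓ₁ c₂ ℓ₂} (R : CommutativeRing c₁ ℓ₁) (S : CommutativeRing c₂ ℓ₂) where
  private
    module R = CommutativeRing R
    module S = CommutativeRing S
    module ιR = IntegerCoefficients R
    module ιS = IntegerCoefficients S
  open SemiringMorphisms (Semiring.rawSemiring R.semiring) (Semiring.rawSemiring S.semiring)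
  open import Relation.Binary.Reasoning.Setoid S.setoid

  module _ {φ : R.Carrier → S.Carrier} (φ-hom : IsSemiringHomomorphism φ) where
    open IsSemiringHomomorphism φ-hom

    homo-ι : ∀ n → φ (ιR.ι n) S.≈ ιS.ι n
    homo-ι zero    = 0#-homo
    homo-ι (suc n) = S.trans (+-homo R.1# (ιR.ι n)) (S.+-cong 1#-homo (homo-ι n))

    homo-evalₚ : ∀ f x → φ (evalₚ R f x) S.≈ evalₚ S f (φ x)
    homo-evalₚ f x = go f R.0# S.0# 0#-homo
      where
      go : ∀ f a b → φ a S.≈ b → φ (Polynomials.horner R x a f) S.≈ Polynomials.horner S (φ x) b f
      go []      a b φa≈b = φa≈b
      go (c ∷ f) a b φa≈b = go f (a R.* x R.+ ιR.ι c) (b S.* φ x S.+ ιS.ι c) (begin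
        φ (a R.* x R.+ ιR.ι c)      ≈⟨ +-homo (a R.* x) (ιR.ι c) ⟩
        φ (a R.* x) S.+ φ (ιR.ι c)  ≈⟨ S.+-cong (S.trans (*-homo a x) (S.*-congʳ φa≈b)) (homo-ι c) ⟩
        b S.* φ x S.+ ιS.ι c        ∎)

remMonicF : (p : ℕ) .{{_ : NonZero p}} → ℕ → List ℕ → List ℕ → List ℕ
remMonicF p zero    ds f       = f
remMonicF p (suc n) ds []      = []
remMonicF p (suc n) ds (c ∷ f) with length ds ≤? length f
... | yes _ = remMonicF p n ds (subFront p f (map (λ d → c ℕ.* d) ds))
... | no  _ = c ∷ f

remMonic : (p : ℕ) .{{_ : NonZero p}} → List ℕ → List ℕ → List ℕ
remMonic p ds f = remMonicF p (length f) ds f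

module _ {p : ℕ} .{{_ : NonZero p}} where

  length-subFront : ∀ as bs → length bs ≤ length as → length (subFront p as bs) ≡ length as
  length-subFront []       []       _         = ≡.refl
  length-subFront (a ∷ as) []       _         = ≡.refl
  length-subFront (a ∷ as) (b ∷ bs) (s≤s le)  = ≡.cong suc (length-subFront as bs le)

  length-subFront-map : ∀ c ds f → length ds ≤ length f →
                        length (subFront p f (map (λ d → c ℕ.* d) ds)) ≡ length f
  length-subFront-map c ds f ds≤f =
    length-subFront f _ (≡.subst (_≤ length f) (≡.sym (Listₚ.length-map _ ds)) ds≤f)

  length-quotMonicF : ∀ n ds f → length f ≤ n → length (quotMonicF p n ds f) ≡ length f ℕ.∸ length ds
  length-quotMonicF zero    ds []      _ = ≡.sym (ℕₚ.0∸n≡0 (length ds))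
  length-quotMonicF (suc n) ds []      _ = ≡.sym (ℕₚ.0∸n≡0 (length ds))
  length-quotMonicF (suc n) ds (c ∷ f) (s≤s f≤n) with length ds ≤? length f
  ... | yes ds≤f = begin
    suc (length (quotMonicF p n ds f′))
      ≡⟨ ≡.cong suc (length-quotMonicF n ds f′ (≡.subst (_≤ n) (≡.sym f′≡f) f≤n)) ⟩
    suc (length f′ ℕ.∸ length ds)
      ≡⟨ ≡.cong (λ k → suc (k ℕ.∸ length ds)) f′≡f ⟩
    suc (length f ℕ.∸ length ds)
      ≡⟨ ℕₚ.+-∸-assoc 1 ds≤f ⟨
    suc (length f) ℕ.∸ length ds ∎
    where
    open ≡.≡-Reasoning
    f′ = subFront p f (map (λ d → c ℕ.* d) ds)
    f′≡f = length-subFront-map c ds f ds≤f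
  ... | no ds≰f = ≡.sym (ℕₚ.m≤n⇒m∸n≡0 (ℕₚ.≰⇒> ds≰f))

  length-remMonicF : ∀ n ds f → length f ≤ n → length (remMonicF p n ds f) ≤ length ds
  length-remMonicF zero    ds []      _ = z≤n
  length-remMonicF (suc n) ds []      _ = z≤n
  length-remMonicF (suc n) ds (c ∷ f) (s≤s f≤n) with length ds ≤? length f
  ... | yes ds≤f = length-remMonicF n ds _ (≡.subst (_≤ n) (≡.sym (length-subFront-map c ds f ds≤f)) f≤n)
  ... | no ds≰f = ℕₚ.≰⇒> ds≰f

module CharacteristicP {c ℓ} (R : CommutativeRing c ℓ) (p : ℕ) .{{_ : NonZero p}} (p-prime : Prime p)
  (char : CommutativeRing._≈_ R (Defs.ι R p) (CommutativeRing.0# R)) where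
  open CommutativeRing R
  open import Relation.Binary.Reasoning.Setoid setoid
  open import Algebra.Properties.Ring ring using (-0#≈0#; +-inverseʳ-unique)
  open import Algebra.Properties.Semiring.Exp semiring using (_^_; ^-congˡ; ^-homo-*; ^-assocʳ)
  open import Algebra.Properties.CommutativeSemiring.Exp commutativeSemiring using (^-distrib-*)
  open import Algebra.Properties.Monoid.Mult *-monoid using (×-idem)
  open SemiringMorphisms (Semiring.rawSemiring semiring) (Semiring.rawSemiring semiring)
  open IntegerCoefficients R
  open Polynomials R

  0^p≈0 : 0# ^ p ≈ 0#
  0^p≈0 = ×-idem (zeroˡ 0#) p

  frobenius-isSemiringHomomorphism : IsSemiringHomomorphism (_^ p)
  frobenius-isSemiringHomomorphism = record
    { isNearSemiringHomomorphism = record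
      { +-isMonoidHomomorphism = record
        { isMagmaHomomorphism = record
          { isRelHomomorphism = record { cong = ^-congˡ p }
          ; homo = Frobenius.frobenius-+ R p-prime char
          }
        ; ε-homo = 0^p≈0
        }
      ; *-homo = λ x y → ^-distrib-* x y p
      }
    ; 1#-homo = ×-idem (*-identityˡ 1#) p
    }

  open IsSemiringHomomorphism frobenius-isSemiringHomomorphism public
    using () renaming (+-homo to frobenius-+; *-homo to frobenius-*; 1#-homo to frobenius-1)

  frobenius-neg : ∀ x → (- x) ^ p ≈ - (x ^ p)
  frobenius-neg x = +-inverseʳ-unique (x ^ p) ((- x) ^ p) (begin
    x ^ p + (- x) ^ p   ≈⟨ frobenius-+ x (- x) ⟨
    (x - x) ^ p         ≈⟨ ^-congˡ p (-‿inverseʳ x) ⟩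
    0# ^ p              ≈⟨ 0^p≈0 ⟩
    0#                  ∎)

  frobenius-- : ∀ x y → (x - y) ^ p ≈ x ^ p - y ^ p
  frobenius-- x y = trans (frobenius-+ x (- y)) (+-congˡ (frobenius-neg y))

  frobenius-ι : ∀ n → ι n ^ p ≈ ι n
  frobenius-ι = homo-ι R R frobenius-isSemiringHomomorphism

  frobenius-fromℕ : ∀ n → fromℕ n ^ p ≈ fromℕ n
  frobenius-fromℕ n = trans (^-congˡ p (fromℕ≈ι n)) (trans (frobenius-ι n) (sym (fromℕ≈ι n)))

  evalₚ-frobenius : ∀ f x → evalₚ R f (x ^ p) ≈ evalₚ R f x ^ p
  evalₚ-frobenius f x = sym (homo-evalₚ R R frobenius-isSemiringHomomorphism f x)

  ^p²≈^p^p : ∀ x → x ^ (p ℕ.^ 2) ≈ (x ^ p) ^ p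
  ^p²≈^p^p x = begin
    x ^ (p ℕ.^ 2)   ≡⟨ ≡.cong (λ n → x ^ (p ℕ.* n)) (ℕₚ.*-identityʳ p) ⟩
    x ^ (p ℕ.* p)   ≈⟨ ^-assocʳ x p p ⟨
    (x ^ p) ^ p     ∎

  evalₚ-root-frobenius : ∀ f x → evalₚ R f x ≈ 0# → evalₚ R f (x ^ p) ≈ 0#
  evalₚ-root-frobenius f x f[x]≈0 = trans (evalₚ-frobenius f x) (trans (^-congˡ p f[x]≈0) 0^p≈0)

  ι-multiple : ∀ {n} → p ∣ n → ι n ≈ 0#
  ι-multiple (divides q ≡.refl) = trans (ι-* q p) (trans (*-congˡ char) (zeroʳ _))

  ι-mod : ∀ n → ι (n % p) ≈ ι n
  ι-mod n = sym (begin
    ι n                              ≡⟨ ≡.cong ι (m≡m%n+[m/n]*n n p) ⟩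
    ι (n % p ℕ.+ (n / p) ℕ.* p)      ≈⟨ ι-+ (n % p) ((n / p) ℕ.* p) ⟩
    ι (n % p) + ι ((n / p) ℕ.* p)    ≈⟨ +-congˡ (ι-multiple (divides (n / p) ≡.refl)) ⟩
    ι (n % p) + 0#                   ≈⟨ +-identityʳ _ ⟩
    ι (n % p)                        ∎)

  ι-∸ : ∀ {m} → m ≤ p → ι (p ℕ.∸ m) ≈ - ι m
  ι-∸ {m} m≤p = +-inverseʳ-unique (ι m) (ι (p ℕ.∸ m)) (begin
    ι m + ι (p ℕ.∸ m)    ≈⟨ ι-+ m (p ℕ.∸ m) ⟨
    ι (m ℕ.+ (p ℕ.∸ m))  ≡⟨ ≡.cong ι (ℕₚ.m+[n∸m]≡n m≤p) ⟩
    ι p                  ≈⟨ char ⟩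
    0#                   ∎)

  ι-subₚ : ∀ a b → ι (subₚ p a b) ≈ ι a - ι b
  ι-subₚ a b = begin
    ι ((a ℕ.+ (p ℕ.∸ (b % p))) % p)  ≈⟨ ι-mod (a ℕ.+ (p ℕ.∸ (b % p))) ⟩
    ι (a ℕ.+ (p ℕ.∸ (b % p)))        ≈⟨ ι-+ a (p ℕ.∸ (b % p)) ⟩
    ι a + ι (p ℕ.∸ (b % p))          ≈⟨ +-congˡ (ι-∸ (ℕₚ.<⇒≤ (m%n<n b p))) ⟩
    ι a - ι (b % p)                  ≈⟨ +-congˡ (-‿cong (ι-mod b)) ⟩
    ι a - ι b                        ∎

  evalₚ-multiples : ∀ {f} → All (p ∣_) f → ∀ x → evalₚ R f x ≈ 0#
  evalₚ-multiples {[]}    []         x = refl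
  evalₚ-multiples {c ∷ f} (p∣c ∷ p∣f) x = begin
    evalₚ R (c ∷ f) x                        ≈⟨ evalₚ-∷ c f x ⟩
    ι c * x ^ length f + evalₚ R f x         ≈⟨ +-cong (*-congʳ (ι-multiple p∣c)) (evalₚ-multiples p∣f x) ⟩
    0# * x ^ length f + 0#                   ≈⟨ +-identityʳ _ ⟩
    0# * x ^ length f                        ≈⟨ zeroˡ _ ⟩
    0#                                       ∎

  evalₚ-subFront : ∀ as bs x → length bs ≤ length as →
                   evalₚ R (subFront p as bs) x ≈ evalₚ R as x - evalₚ R bs x * x ^ (length as ℕ.∸ length bs)
  evalₚ-subFront []       []       x _ = sym (trans (+-congˡ (trans (-‿cong (zeroˡ _)) -0#≈0#)) (+-identityʳ _))
  evalₚ-subFront (a ∷ as) []       x _ = sym (trans (+-congˡ (trans (-‿cong (zeroˡ _)) -0#≈0#)) (+-identityʳ _))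
  evalₚ-subFront (a ∷ as) (b ∷ bs) x (s≤s bs≤as) = begin
    evalₚ R (subₚ p a b ∷ subFront p as bs) x
      ≈⟨ evalₚ-∷ (subₚ p a b) (subFront p as bs) x ⟩
    ι (subₚ p a b) * x ^ length (subFront p as bs) + evalₚ R (subFront p as bs) x
      ≡⟨ ≡.cong (λ k → ι (subₚ p a b) * x ^ k + evalₚ R (subFront p as bs) x) (length-subFront as bs bs≤as) ⟩
    ι (subₚ p a b) * x ^ length as + evalₚ R (subFront p as bs) x
      ≈⟨ +-cong (*-cong (ι-subₚ a b) x^as≈x^bs*y) (evalₚ-subFront as bs x bs≤as) ⟩
    (ι a - ι b) * (x ^ length bs * y) + (evalₚ R as x - evalₚ R bs x * y)
      ≈⟨ solve 6 (λ a b z y e f → (a :- b) :* (z :* y) :+ (e :- f :* y) := (a :* (z :* y) :+ e) :- (b :* z :+ f) :* y)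
               refl (ι a) (ι b) (x ^ length bs) y (evalₚ R as x) (evalₚ R bs x) ⟩
    (ι a * (x ^ length bs * y) + evalₚ R as x) - (ι b * x ^ length bs + evalₚ R bs x) * y
      ≈⟨ +-cong (trans (evalₚ-∷ a as x) (+-congʳ (*-congˡ x^as≈x^bs*y)))
                (-‿cong (*-congʳ (evalₚ-∷ b bs x))) ⟨
    evalₚ R (a ∷ as) x - evalₚ R (b ∷ bs) x * y
      ∎
    where
    y = x ^ (length as ℕ.∸ length bs)
    x^as≈x^bs*y : x ^ length as ≈ x ^ length bs * y
    x^as≈x^bs*y = trans (reflexive (≡.cong (x ^_) (≡.sym (ℕₚ.m+[n∸m]≡n bs≤as)))) (^-homo-* x (length bs) _)

  evalₚ-subFront-map : ∀ c ds f x → length ds ≤ length f →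
    evalₚ R f x ≈
    evalₚ R (subFront p f (map (λ d → c ℕ.* d) ds)) x + ι c * evalₚ R ds x * x ^ (length f ℕ.∸ length ds)
  evalₚ-subFront-map c ds f x ds≤f = begin
    evalₚ R f x
      ≈⟨ solve 3 (λ e a y → e := (e :- a :* y) :+ a :* y) refl (evalₚ R f x) (ι c * evalₚ R ds x) y ⟩
    (evalₚ R f x - ι c * evalₚ R ds x * y) + ι c * evalₚ R ds x * y
      ≈⟨ +-congʳ (+-congˡ (-‿cong (*-congʳ (evalₚ-map-* c ds x)))) ⟨
    (evalₚ R f x - evalₚ R cds x * y) + ι c * evalₚ R ds x * y
      ≡⟨ ≡.cong (λ k → (evalₚ R f x - evalₚ R cds x * x ^ (length f ℕ.∸ k)) + ι c * evalₚ R ds x * y)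
                (Listₚ.length-map _ ds) ⟨
    (evalₚ R f x - evalₚ R cds x * x ^ (length f ℕ.∸ length cds)) + ι c * evalₚ R ds x * y
      ≈⟨ +-congʳ (evalₚ-subFront f cds x (≡.subst (_≤ length f) (≡.sym (Listₚ.length-map _ ds)) ds≤f)) ⟨
    evalₚ R (subFront p f cds) x + ι c * evalₚ R ds x * y
      ∎
    where
    cds = map (λ d → c ℕ.* d) ds
    y = x ^ (length f ℕ.∸ length ds)

  evalₚ-quotMonicF : ∀ n ds f x → length f ≤ n →
    evalₚ R f x ≈ evalₚ R (quotMonicF p n ds f) x * evalMonicₚ ds x + evalₚ R (remMonicF p n ds f) x
  evalₚ-quotMonicF zero    ds []      x _ = sym (trans (+-identityʳ _) (zeroˡ _))
  evalₚ-quotMonicF (suc n) ds []      x _ = sym (trans (+-identityʳ _) (zeroˡ _))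
  evalₚ-quotMonicF (suc n) ds (c ∷ f) x (s≤s f≤n) with length ds ≤? length f
  ... | no  _    = sym (trans (+-congʳ (zeroˡ _)) (+-identityˡ _))
  ... | yes ds≤f = begin
    evalₚ R (c ∷ f) x
      ≈⟨ evalₚ-∷ c f x ⟩
    ι c * x ^ length f + evalₚ R f x
      ≈⟨ +-cong (*-congˡ x^f≈x^ds*y) (evalₚ-subFront-map c ds f x ds≤f) ⟩
    ι c * (x ^ length ds * y) + (evalₚ R f′ x + ι c * evalₚ R ds x * y)
      ≈⟨ +-congˡ (+-congʳ (evalₚ-quotMonicF n ds f′ x f′≤n)) ⟩
    ι c * (x ^ length ds * y) + ((evalₚ R q′ x * evalMonicₚ ds x + evalₚ R r′ x) + ι c * evalₚ R ds x * y)
      ≈⟨ solve 6 (λ c z y q r e → c :* (z :* y) :+ ((q :* (z :+ e) :+ r) :+ c :* e :* y)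
                                  := (c :* y :+ q) :* (z :+ e) :+ r)
               refl (ι c) (x ^ length ds) y (evalₚ R q′ x) (evalₚ R r′ x) (evalₚ R ds x) ⟩
    (ι c * y + evalₚ R q′ x) * evalMonicₚ ds x + evalₚ R r′ x
      ≈⟨ +-congʳ (*-congʳ (trans (evalₚ-∷ (c % p) q′ x)
                                 (+-congʳ (*-cong (ι-mod c) (reflexive (≡.cong (x ^_) q′≡f∸ds)))))) ⟨
    evalₚ R ((c % p) ∷ q′) x * evalMonicₚ ds x + evalₚ R r′ x
      ∎
    where
    cds = map (λ d → c ℕ.* d) ds
    f′ = subFront p f cds
    q′ = quotMonicF p n ds f′
    r′ = remMonicF p n ds f′
    y = x ^ (length f ℕ.∸ length ds)
    f′≡f : length f′ ≡ length f
    f′≡f = length-subFront-map c ds f ds≤f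
    f′≤n : length f′ ≤ n
    f′≤n = ≡.subst (_≤ n) (≡.sym f′≡f) f≤n
    q′≡f∸ds : length q′ ≡ length f ℕ.∸ length ds
    q′≡f∸ds = ≡.trans (length-quotMonicF n ds f′ f′≤n) (≡.cong (ℕ._∸ length ds) f′≡f)
    x^f≈x^ds*y : x ^ length f ≈ x ^ length ds * y
    x^f≈x^ds*y = trans (reflexive (≡.cong (x ^_) (≡.sym (ℕₚ.m+[n∸m]≡n ds≤f)))) (^-homo-* x (length ds) _)

  evalₚ-division : ∀ ds f x →
    evalₚ R f x ≈ evalₚ R (quotMonic p ds f) x * evalMonicₚ ds x + evalₚ R (remMonic p ds f) x
  evalₚ-division ds f x = evalₚ-quotMonicF (length f) ds f x ℕₚ.≤-refl

  length-remMonic : ∀ ds f → length (remMonic p ds f) ≤ length ds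
  length-remMonic ds f = length-remMonicF (length f) ds f ℕₚ.≤-refl

  evalₚ-quotient-root : ∀ ds f x → All (p ∣_) (remMonic p ds f) →
    evalₚ R (quotMonic p ds f) x ≈ 0# → evalₚ R f x ≈ 0#
  evalₚ-quotient-root ds f x rem≡0 q[x]≈0 = begin
    evalₚ R f x
      ≈⟨ evalₚ-division ds f x ⟩
    evalₚ R (quotMonic p ds f) x * evalMonicₚ ds x + evalₚ R (remMonic p ds f) x
      ≈⟨ +-cong (trans (*-congʳ q[x]≈0) (zeroˡ _)) (evalₚ-multiples rem≡0 x) ⟩
    0# + 0#
      ≈⟨ +-identityʳ 0# ⟩
    0# ∎

  evalₚ-remMonic-common-root : ∀ ds f x → evalMonicₚ ds x ≈ 0# → evalₚ R f x ≈ 0# →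
                               evalₚ R (remMonic p ds f) x ≈ 0#
  evalₚ-remMonic-common-root ds f x m[x]≈0 f[x]≈0 = begin
    evalₚ R (remMonic p ds f) x
      ≈⟨ +-identityˡ _ ⟨
    0# + evalₚ R (remMonic p ds f) x
      ≈⟨ +-congʳ (trans (*-congˡ m[x]≈0) (zeroʳ _)) ⟨
    evalₚ R (quotMonic p ds f) x * evalMonicₚ ds x + evalₚ R (remMonic p ds f) x
      ≈⟨ evalₚ-division ds f x ⟨
    evalₚ R f x
      ≈⟨ f[x]≈0 ⟩
    0# ∎

-- (a , b) stands for a + b ε with ε² = 0; then f (a + ε) = f a + f′ a ε, which defines derivₚ.
module DualNumbers {c ℓ} (R : CommutativeRing c ℓ) where
  open CommutativeRing R
  open IntegerCoefficients R
  open import Algebra.Properties.Semiring.Exp semiring using (_^_)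

  _≈ᴰ_ : Carrier × Carrier → Carrier × Carrier → Set ℓ
  (a , b) ≈ᴰ (c , d) = (a ≈ c) × (b ≈ d)

  _+ᴰ_ _*ᴰ_ : Carrier × Carrier → Carrier × Carrier → Carrier × Carrier
  (a , b) +ᴰ (c , d) = (a + c , b + d)
  (a , b) *ᴰ (c , d) = (a * c , a * d + b * c)

  -ᴰ_ : Carrier × Carrier → Carrier × Carrier
  -ᴰ (a , b) = (- a , - b)

  dual-isCommutativeRing : IsCommutativeRing _≈ᴰ_ _+ᴰ_ _*ᴰ_ -ᴰ_ (0# , 0#) (1# , 0#)
  dual-isCommutativeRing = record
    { isRing = record
      { +-isAbelianGroup = record
        { isGroup = record
          { isMonoid = record
            { isSemigroup = record
              { isMagma = record
                { isEquivalence = record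
                  { refl  = refl , refl
                  ; sym   = λ (a , b) → sym a , sym b
                  ; trans = λ (a , b) (c , d) → trans a c , trans b d
                  }
                ; ∙-cong = λ (a , b) (c , d) → +-cong a c , +-cong b d
                }
              ; assoc = λ (a , b) (c , d) (e , f) → +-assoc a c e , +-assoc b d f
              }
            ; identity = (λ (a , b) → +-identityˡ a , +-identityˡ b) , (λ (a , b) → +-identityʳ a , +-identityʳ b)
            }
          ; inverse = (λ (a , b) → -‿inverseˡ a , -‿inverseˡ b) , (λ (a , b) → -‿inverseʳ a , -‿inverseʳ b)
          ; ⁻¹-cong = λ (a , b) → -‿cong a , -‿cong b
          }
        ; comm = λ (a , b) (c , d) → +-comm a c , +-comm b d
        }
      ; *-cong = λ (a , b) (c , d) → *-cong a c , +-cong (*-cong a d) (*-cong b c)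
      ; *-assoc = λ (a , b) (c , d) (e , f) → *-assoc a c e ,
          solve 6 (λ a b c d e f → (a :* c) :* f :+ (a :* d :+ b :* c) :* e
                                  := a :* (c :* f :+ d :* e) :+ b :* (c :* e))
                refl a b c d e f
      ; *-identity = (λ (a , b) → *-identityˡ a , solve 2 (λ a b → con (+ 1) :* b :+ con (+ 0) :* a := b) refl a b)
                   , (λ (a , b) → *-identityʳ a , solve 2 (λ a b → a :* con (+ 0) :+ b :* con (+ 1) := b) refl a b)
      ; distrib = (λ (a , b) (c , d) (e , f) → distribˡ a c e ,
                    solve 6 (λ a b c d e f → a :* (d :+ f) :+ b :* (c :+ e)
                                            := (a :* d :+ b :* c) :+ (a :* f :+ b :* e))
                          refl a b c d e f)
                , (λ (a , b) (c , d) (e , f) → distribʳ a c e ,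
                    solve 6 (λ a b c d e f → (c :+ e) :* b :+ (d :+ f) :* a
                                            := (c :* b :+ d :* a) :+ (e :* b :+ f :* a))
                          refl a b c d e f)
      }
    ; *-comm = λ (a , b) (c , d) → *-comm a c , solve 4 (λ a b c d → a :* d :+ b :* c := c :* b :+ d :* a)
                                                      refl a b c d
    }

  Dual : CommutativeRing c ℓ
  Dual = record { isCommutativeRing = dual-isCommutativeRing }

  private
    module D = CommutativeRing Dual
    module ιD = IntegerCoefficients Dual
  open import Algebra.Properties.Semiring.Exp D.semiring using () renaming (_^_ to _^ᴰ_)
  open SemiringMorphisms (Semiring.rawSemiring D.semiring) (Semiring.rawSemiring semiring)

  proj₁-isSemiringHomomorphism : IsSemiringHomomorphism proj₁
  proj₁-isSemiringHomomorphism = record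
    { isNearSemiringHomomorphism = record
      { +-isMonoidHomomorphism = record
        { isMagmaHomomorphism = record
          { isRelHomomorphism = record { cong = proj₁ }
          ; homo = λ _ _ → refl
          }
        ; ε-homo = refl
        }
      ; *-homo = λ _ _ → refl
      }
    ; 1#-homo = refl
    }

  ι-dual : ∀ n → ιD.ι n D.≈ (ι n , 0#)
  ι-dual zero    = refl , refl
  ι-dual (suc n) = +-congˡ (proj₁ (ι-dual n)) , trans (+-congˡ (proj₂ (ι-dual n))) (+-identityˡ 0#)

  proj₁-^ : ∀ x n → proj₁ (x ^ᴰ n) ≈ proj₁ x ^ n
  proj₁-^ x zero    = refl
  proj₁-^ x (suc n) = *-congˡ (proj₁-^ x n)

  proj₂-^ : ∀ a b n → proj₂ ((a , b) ^ᴰ n) ≈ ι n * a ^ (n ℕ.∸ 1) * b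
  proj₂-^ a b zero          = sym (trans (*-congʳ (zeroˡ 1#)) (zeroˡ b))
  proj₂-^ a b (suc zero)    = solve 2 (λ a b → a :* con (+ 0) :+ b :* con (+ 1)
                                              := (con (+ 1) :+ con (+ 0)) :* con (+ 1) :* b)
                                    refl a b
  proj₂-^ a b (suc (suc n)) = begin
    a * proj₂ ((a , b) ^ᴰ suc n) + b * proj₁ ((a , b) ^ᴰ suc n)
      ≈⟨ +-cong (*-congˡ (proj₂-^ a b (suc n))) (*-congˡ (proj₁-^ (a , b) (suc n))) ⟩
    a * (ι (suc n) * a ^ n * b) + b * (a * a ^ n)
      ≈⟨ solve 4 (λ a b k y → a :* (k :* y :* b) :+ b :* (a :* y) := (con (+ 1) :+ k) :* (a :* y) :* b)
               refl a b (ι (suc n)) (a ^ n) ⟩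
    ι (suc (suc n)) * a ^ suc n * b
      ∎
    where open import Relation.Binary.Reasoning.Setoid setoid

  derivₚ : List ℕ → Carrier → Carrier
  derivₚ f a = proj₂ (evalₚ Dual f (a , 1#))

  module _ (p : ℕ) .{{_ : NonZero p}} (p-prime : Prime p) (char : ι p ≈ 0#) where
    open import Relation.Binary.Reasoning.Setoid setoid
    open Polynomials using (evalMonicₚ)

    dual-char : ιD.ι p D.≈ (0# , 0#)
    dual-char = trans (proj₁ (ι-dual p)) char , proj₂ (ι-dual p)

    open CharacteristicP Dual p p-prime dual-char using (evalₚ-division; evalₚ-multiples)

    proj₁-evalₚ : ∀ f x → proj₁ (evalₚ Dual f x) ≈ evalₚ R f (proj₁ x)
    proj₁-evalₚ = homo-evalₚ Dual R proj₁-isSemiringHomomorphism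

    derivₚ-double-root : ∀ ds f a → All (p ∣_) (remMonic p ds f) →
      evalₚ R (quotMonic p ds f) a ≈ 0# → evalMonicₚ R ds a ≈ 0# → derivₚ f a ≈ 0#
    derivₚ-double-root ds f a rem≡0 q[a]≈0 m[a]≈0 = begin
      proj₂ (evalₚ Dual f X)
        ≈⟨ proj₂ (evalₚ-division ds f X) ⟩
      (proj₁ Q * proj₂ M + proj₂ Q * proj₁ M) + proj₂ (evalₚ Dual (remMonic p ds f) X)
        ≈⟨ +-cong (+-cong (*-congʳ (trans (proj₁-evalₚ (quotMonic p ds f) X) q[a]≈0))
                          (*-congˡ (trans (+-cong (proj₁-^ X (length ds)) (proj₁-evalₚ ds X)) m[a]≈0)))
                  (proj₂ (evalₚ-multiples rem≡0 X)) ⟩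
      (0# * proj₂ M + proj₂ Q * 0#) + 0#
        ≈⟨ solve 2 (λ x y → (con (+ 0) :* x :+ y :* con (+ 0)) :+ con (+ 0) := con (+ 0))
                 refl (proj₂ M) (proj₂ Q) ⟩
      0#
        ∎
      where
      X = (a , 1#)
      Q = evalₚ Dual (quotMonic p ds f) X
      M = evalMonicₚ Dual ds X

record IsField {c ℓ} (K : CommutativeRing c ℓ) : Set (c ⊔ ℓ) where
  open CommutativeRing K
  field
    1≉0     : ¬ 1# ≈ 0#
    inverse : ∀ x → ¬ x ≈ 0# → ∃ λ y → x * y ≈ 1#

module MonicPolynomials {c ℓ} (R : CommutativeRing c ℓ) where
  open CommutativeRing R
  open import Relation.Binary.Reasoning.Setoid setoid
  open IntegerCoefficients R
  open import Algebra.Properties.Semiring.Exp semiring using (_^_)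

  -- monic (c₀ ∷ … ∷ cₙ₋₁) x = x ^ n + cₙ₋₁ x ^ (n − 1) + … + c₀: lowest coefficient first,
  -- unlike the lists of Defs.
  monic : ∀ {n} → Vec Carrier n → Carrier → Carrier
  monic []       x = 1#
  monic (c ∷ cs) x = c + x * monic cs x

  quotLinear : ∀ {n} → Carrier → Vec Carrier (suc n) → Vec Carrier n
  quotLinear a (c ∷ [])         = []
  quotLinear a (c ∷ cs@(_ ∷ _)) = monic cs a ∷ quotLinear a cs

  monic-factor : ∀ {n} a (cs : Vec Carrier (suc n)) x →
                 monic cs x ≈ (x - a) * monic (quotLinear a cs) x + monic cs a
  monic-factor a (c ∷ [])         x =
    solve 3 (λ c x a → c :+ x :* con (+ 1) := (x :- a) :* con (+ 1) :+ (c :+ a :* con (+ 1))) refl c x a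
  monic-factor a (c ∷ cs@(_ ∷ _)) x = begin
    c + x * monic cs x
      ≈⟨ +-congˡ (*-congˡ (monic-factor a cs x)) ⟩
    c + x * ((x - a) * monic (quotLinear a cs) x + monic cs a)
      ≈⟨ solve 5 (λ c x a g m → c :+ x :* ((x :- a) :* g :+ m) := (x :- a) :* (m :+ x :* g) :+ (c :+ a :* m))
               refl c x a (monic (quotLinear a cs) x) (monic cs a) ⟩
    (x - a) * (monic cs a + x * monic (quotLinear a cs) x) + (c + a * monic cs a)
      ∎

  monic-zeros : ∀ n x → monic (Vec.replicate n 0#) x ≈ x ^ n
  monic-zeros zero    x = refl
  monic-zeros (suc n) x = trans (+-identityˡ _) (*-congˡ (monic-zeros n x))

  monic-X^n-X : ∀ n → 2 ≤ n → ∃ λ (cs : Vec Carrier n) → ∀ x → monic cs x ≈ x ^ n - x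
  monic-X^n-X (suc zero)    (s≤s ())
  monic-X^n-X (suc (suc n)) _ = 0# ∷ - 1# ∷ Vec.replicate n 0# , λ x → begin
    0# + x * (- 1# + x * monic (Vec.replicate n 0#) x)
      ≈⟨ +-congˡ (*-congˡ (+-congˡ (*-congˡ (monic-zeros n x)))) ⟩
    0# + x * (- 1# + x * x ^ n)
      ≈⟨ solve 2 (λ x y → con (+ 0) :+ x :* (:- con (+ 1) :+ x :* y) := x :* (x :* y) :- x) refl x (x ^ n) ⟩
    x * (x * x ^ n) - x ∎

module Field {c ℓ} (K : CommutativeRing c ℓ) (isField : IsField K) where
  open CommutativeRing K
  open IsField isField
  open import Relation.Binary.Reasoning.Setoid setoid
  open import Algebra.Properties.Ring ring using (x∙y⁻¹≈ε⇒x≈y)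
  open MonicPolynomials K

  *-cancelˡ : ∀ {x y z} → ¬ x ≈ 0# → x * y ≈ x * z → y ≈ z
  *-cancelˡ {x} {y} {z} x≉0 xy≈xz with inverse x x≉0
  ... | x⁻¹ , xx⁻¹≈1 = begin
    y                ≈⟨ *-identityˡ y ⟨
    1# * y           ≈⟨ *-congʳ (trans (*-comm x⁻¹ x) xx⁻¹≈1) ⟨
    (x⁻¹ * x) * y    ≈⟨ *-assoc x⁻¹ x y ⟩
    x⁻¹ * (x * y)    ≈⟨ *-congˡ xy≈xz ⟩
    x⁻¹ * (x * z)    ≈⟨ *-assoc x⁻¹ x z ⟨
    (x⁻¹ * x) * z    ≈⟨ *-congʳ (trans (*-comm x⁻¹ x) xx⁻¹≈1) ⟩
    1# * z           ≈⟨ *-identityˡ z ⟩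
    z                ∎

  x≉0∧xy≈0⇒y≈0 : ∀ {x y} → ¬ x ≈ 0# → x * y ≈ 0# → y ≈ 0#
  x≉0∧xy≈0⇒y≈0 {x} x≉0 xy≈0 = *-cancelˡ x≉0 (trans xy≈0 (sym (zeroʳ x)))

  x≉y⇒x-y≉0 : ∀ {x y} → ¬ x ≈ y → ¬ x - y ≈ 0#
  x≉y⇒x-y≉0 x≉y x-y≈0 = x≉y (x∙y⁻¹≈ε⇒x≈y _ _ x-y≈0)

  monic-roots-bound : ∀ {n} (cs : Vec Carrier n) (r : Fin (suc n) → Carrier) →
                      Injective _≡_ _≈_ r → (∀ i → monic cs (r i) ≈ 0#) → ⊥
  monic-roots-bound []           r r-inj roots = 1≉0 (roots Fin.zero)
  monic-roots-bound cs@(_ ∷ _)   r r-inj roots =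
    monic-roots-bound (quotLinear a cs) (λ i → r (Fin.suc i))
                      (λ ri≈rj → Finₚ.suc-injective (r-inj ri≈rj)) quotient-roots
    where
    a = r Fin.zero
    quotient-roots : ∀ i → monic (quotLinear a cs) (r (Fin.suc i)) ≈ 0#
    quotient-roots i = x≉0∧xy≈0⇒y≈0 (x≉y⇒x-y≉0 (λ ri≈a → Finₚ.0≢1+n (≡.sym (r-inj ri≈a)))) (begin
      (r (Fin.suc i) - a) * monic (quotLinear a cs) (r (Fin.suc i))
        ≈⟨ +-identityʳ _ ⟨
      (r (Fin.suc i) - a) * monic (quotLinear a cs) (r (Fin.suc i)) + 0#
        ≈⟨ +-congˡ (roots Fin.zero) ⟨
      (r (Fin.suc i) - a) * monic (quotLinear a cs) (r (Fin.suc i)) + monic cs a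
        ≈⟨ monic-factor a cs (r (Fin.suc i)) ⟨
      monic cs (r (Fin.suc i))
        ≈⟨ roots (Fin.suc i) ⟩
      0# ∎)

module PrimeField {c ℓ} (K : CommutativeRing c ℓ) (p : ℕ) .{{_ : NonZero p}} (p-prime : Prime p)
  (char : CommutativeRing._≈_ K (Defs.ι K p) (CommutativeRing.0# K)) (isField : IsField K) where
  open CommutativeRing K
  open IsField isField
  open import Relation.Binary.Reasoning.Setoid setoid
  open import Algebra.Properties.Semiring.Exp semiring using (_^_; ^-congˡ)
  open import Algebra.Properties.Ring ring using (+-identityʳ-unique)
  open IntegerCoefficients K
  open CharacteristicP K p p-prime char
  open Field K isField
  open MonicPolynomials K
  open Polynomials K

  ι≉0 : ∀ {k} → 0 < k → k < p → ¬ ι k ≈ 0#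
  ι≉0 {k@(suc _)} _ k<p ι[k]≈0 with coprime-Bézout (prime⇒coprime p-prime k<p)
  ... | Bézout.+- x y eq = 1≉0 (begin
    1#                   ≈⟨ +-identityʳ 1# ⟨
    1# + 0#              ≈⟨ +-congˡ (trans (*-congˡ ι[k]≈0) (zeroʳ (ι y))) ⟨
    1# + ι y * ι k       ≈⟨ +-congˡ (ι-* y k) ⟨
    ι (1 ℕ.+ y ℕ.* k)    ≡⟨ ≡.cong ι eq ⟩
    ι (x ℕ.* p)          ≈⟨ ι-multiple (divides x ≡.refl) ⟩
    0#                   ∎)
  ... | Bézout.-+ x y eq = 1≉0 (begin
    1#                   ≈⟨ +-identityʳ 1# ⟨
    1# + 0#              ≈⟨ +-congˡ (ι-multiple (divides x ≡.refl)) ⟨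
    ι (1 ℕ.+ x ℕ.* p)    ≡⟨ ≡.cong ι eq ⟩
    ι (y ℕ.* k)          ≈⟨ ι-* y k ⟩
    ι y * ι k            ≈⟨ trans (*-congˡ ι[k]≈0) (zeroʳ (ι y)) ⟩
    0#                   ∎)

  ι-injective-< : ∀ {a b} → a < b → b < p → ¬ ι a ≈ ι b
  ι-injective-< {a} {b} a<b b<p ι[a]≈ι[b] =
    ι≉0 (ℕₚ.m<n⇒0<n∸m a<b) (ℕₚ.≤-<-trans (ℕₚ.m∸n≤m b a) b<p)
        (+-identityʳ-unique (ι b) (ι (b ℕ.∸ a)) (begin
      ι b + ι (b ℕ.∸ a)    ≈⟨ +-congʳ ι[a]≈ι[b] ⟨
      ι a + ι (b ℕ.∸ a)    ≈⟨ ι-+ a (b ℕ.∸ a) ⟨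
      ι (a ℕ.+ (b ℕ.∸ a))  ≡⟨ ≡.cong ι (ℕₚ.m+[n∸m]≡n (ℕₚ.<⇒≤ a<b)) ⟩
      ι b                  ∎))

  ι-injective-mod : ∀ {m n} → ι m ≈ ι n → m % p ≡ n % p
  ι-injective-mod {m} {n} ι[m]≈ι[n] with ℕₚ.<-cmp (m % p) (n % p)
  ... | tri< m%p<n%p _ _ = ⊥-elim (ι-injective-< m%p<n%p (m%n<n n p) ι[m%p]≈ι[n%p])
    where ι[m%p]≈ι[n%p] = trans (ι-mod m) (trans ι[m]≈ι[n] (sym (ι-mod n)))
  ... | tri≈ _ m%p≡n%p _ = m%p≡n%p
  ... | tri> _ _ n%p<m%p = ⊥-elim (ι-injective-< n%p<m%p (m%n<n m p) ι[n%p]≈ι[m%p])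
    where ι[n%p]≈ι[m%p] = trans (ι-mod n) (trans (sym ι[m]≈ι[n]) (sym (ι-mod m)))

  ι≈0⇒%≡0 : ∀ {m} → ι m ≈ 0# → m % p ≡ 0
  ι≈0⇒%≡0 ι[m]≈0 = ≡.trans (ι-injective-mod {n = 0} ι[m]≈0) (m<n⇒m%n≡m (ℕ.>-nonZero⁻¹ p))

  %≢0⇒ι≉0 : ∀ {m} → ¬ m % p ≡ 0 → ¬ ι m ≈ 0#
  %≢0⇒ι≉0 m%p≢0 ι[m]≈0 = m%p≢0 (ι≈0⇒%≡0 ι[m]≈0)

  ι≈0⇒p∣ : ∀ {m} → ι m ≈ 0# → p ∣ m
  ι≈0⇒p∣ {m} ι[m]≈0 = m%n≡0⇒n∣m m p (ι≈0⇒%≡0 ι[m]≈0)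

  ι2≉0 : ¬ p ≡ 2 → ¬ ι 2 ≈ 0#
  ι2≉0 p≢2 = ι≉0 (s≤s z≤n)
    (ℕₚ.≤∧≢⇒< (nonTrivial⇒n>1 p {{prime⇒nonTrivial p-prime}}) (λ 2≡p → p≢2 (≡.sym 2≡p)))

  ∉𝔽ₚ⇒^p≉id : ∀ w → (∀ i → i < p → ¬ w ≈ ι i) → ¬ w ^ p ≈ w
  ∉𝔽ₚ⇒^p≉id w w∉𝔽ₚ w^p≈w with monic-X^n-X p (nonTrivial⇒n>1 p {{prime⇒nonTrivial p-prime}})
  ... | cs , cs≈X^p-X = monic-roots-bound cs r r-injective roots
    where
    r : Fin (suc p) → Carrier
    r Fin.zero    = w
    r (Fin.suc i) = ι (Fin.toℕ i)
    ι-injective : ∀ {i j : Fin p} → ι (Fin.toℕ i) ≈ ι (Fin.toℕ j) → i ≡ j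
    ι-injective {i} {j} ι[i]≈ι[j] = Finₚ.toℕ-injective
      (≡.trans (≡.sym (m<n⇒m%n≡m (Finₚ.toℕ<n i)))
               (≡.trans (ι-injective-mod ι[i]≈ι[j]) (m<n⇒m%n≡m (Finₚ.toℕ<n j))))
    r-injective : Injective _≡_ _≈_ r
    r-injective {Fin.zero}  {Fin.zero}  _     = ≡.refl
    r-injective {Fin.zero}  {Fin.suc j} w≈ι   = ⊥-elim (w∉𝔽ₚ (Fin.toℕ j) (Finₚ.toℕ<n j) w≈ι)
    r-injective {Fin.suc i} {Fin.zero}  ι≈w   = ⊥-elim (w∉𝔽ₚ (Fin.toℕ i) (Finₚ.toℕ<n i) (sym ι≈w))
    r-injective {Fin.suc i} {Fin.suc j} ι≈ι   = ≡.cong Fin.suc (ι-injective ι≈ι)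
    roots : ∀ i → monic cs (r i) ≈ 0#
    roots Fin.zero    = trans (cs≈X^p-X w) (trans (+-congʳ w^p≈w) (-‿inverseʳ w))
    roots (Fin.suc i) = trans (cs≈X^p-X _) (trans (+-congʳ (frobenius-ι (Fin.toℕ i))) (-‿inverseʳ _))

  frobenius-fixes-inverse : ∀ {x y} → ¬ x ≈ 0# → x ^ p ≈ x → x * y ≈ 1# → y ^ p ≈ y
  frobenius-fixes-inverse {x} {y} x≉0 x^p≈x xy≈1 = *-cancelˡ x≉0 (begin
    x * y ^ p       ≈⟨ *-congʳ x^p≈x ⟨
    x ^ p * y ^ p   ≈⟨ frobenius-* x y ⟨
    (x * y) ^ p     ≈⟨ ^-congˡ p xy≈1 ⟩
    1# ^ p          ≈⟨ frobenius-1 ⟩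
    1#              ≈⟨ xy≈1 ⟨
    x * y           ∎)

  vanishing-constant⇒p∣ : ∀ l x → length l ≤ 1 → evalₚ K l x ≈ 0# → All (p ∣_) l
  vanishing-constant⇒p∣ []          x _ _      = []
  vanishing-constant⇒p∣ (c ∷ [])    x _ l[x]≈0 = ι≈0⇒p∣ (trans (sym (evalₚ-[ c ] x)) l[x]≈0) ∷ []
  vanishing-constant⇒p∣ (_ ∷ _ ∷ _) x (s≤s ())

  vanishing-linear⇒p∣ : ∀ l a b → length l ≤ 2 → ¬ a ≈ b →
                        evalₚ K l a ≈ 0# → evalₚ K l b ≈ 0# → All (p ∣_) l
  vanishing-linear⇒p∣ []             a b _ _   _      _      = []
  vanishing-linear⇒p∣ (c ∷ [])       a b _ _   l[a]≈0 _      = vanishing-constant⇒p∣ (c ∷ []) a (s≤s z≤n) l[a]≈0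
  vanishing-linear⇒p∣ (c₁ ∷ c₀ ∷ []) a b _ a≉b l[a]≈0 l[b]≈0 = ι≈0⇒p∣ ι[c₁]≈0 ∷ ι≈0⇒p∣ ι[c₀]≈0 ∷ []
    where
    linear : ∀ x → evalₚ K (c₁ ∷ c₀ ∷ []) x ≈ ι c₁ * x + ι c₀
    linear x = trans (evalₚ-∷ c₁ (c₀ ∷ []) x) (+-cong (*-congˡ (*-identityʳ x)) (evalₚ-[ c₀ ] x))
    ι[c₁]≈0 : ι c₁ ≈ 0#
    ι[c₁]≈0 = x≉0∧xy≈0⇒y≈0 (x≉y⇒x-y≉0 a≉b) (begin
      (a - b) * ι c₁
        ≈⟨ solve 4 (λ a b c d → (a :- b) :* c := (c :* a :+ d) :- (c :* b :+ d)) refl a b (ι c₁) (ι c₀) ⟩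
      (ι c₁ * a + ι c₀) - (ι c₁ * b + ι c₀)
        ≈⟨ +-cong (trans (sym (linear a)) l[a]≈0) (-‿cong (trans (sym (linear b)) l[b]≈0)) ⟩
      0# - 0#
        ≈⟨ -‿inverseʳ 0# ⟩
      0# ∎)
    ι[c₀]≈0 : ι c₀ ≈ 0#
    ι[c₀]≈0 = begin
      ι c₀                    ≈⟨ +-identityˡ _ ⟨
      0# + ι c₀               ≈⟨ +-congʳ (trans (*-congʳ ι[c₁]≈0) (zeroˡ a)) ⟨
      ι c₁ * a + ι c₀         ≈⟨ linear a ⟨
      evalₚ K (c₁ ∷ c₀ ∷ []) a ≈⟨ l[a]≈0 ⟩
      0#                      ∎
  vanishing-linear⇒p∣ (_ ∷ _ ∷ _ ∷ _) a b (s≤s (s≤s ()))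

module GammaPolynomial {c ℓ} (R : CommutativeRing c ℓ) (p : ℕ) .{{_ : NonZero p}} (p-prime : Prime p)
  (char : CommutativeRing._≈_ R (Defs.ι R p) (CommutativeRing.0# R)) where
  open CommutativeRing R
  open import Relation.Binary.Reasoning.Setoid setoid
  open import Algebra.Properties.Semiring.Exp semiring using (_^_)
  open IntegerCoefficients R
  open Polynomials R
  open CharacteristicP R p p-prime char

  length-γ-tail : length (replicate (p ℕ.∸ 2) 0 ++ 1 ∷ 1 ∷ []) ≡ p
  length-γ-tail = ≡.trans (Listₚ.length-++ (replicate (p ℕ.∸ 2) 0))
    (≡.trans (≡.cong (ℕ._+ 2) (Listₚ.length-replicate (p ℕ.∸ 2)))
             (ℕₚ.m∸n+n≡m (nonTrivial⇒n>1 p {{prime⇒nonTrivial p-prime}})))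

  evalₚ-γ : ∀ z x → evalₚ R (γ p z) x ≈ x ^ suc p + ι (1 ℕ.+ z) * x ^ p + (x + 1#)
  evalₚ-γ z x = begin
    evalₚ R (1 ∷ a ∷ T) x
      ≈⟨ trans (evalₚ-∷ 1 (a ∷ T) x) (+-congˡ (evalₚ-∷ a T x)) ⟩
    ι 1 * x ^ suc (length T) + (ι a * x ^ length T + evalₚ R T x)
      ≡⟨ ≡.cong (λ n → ι 1 * x ^ suc n + (ι a * x ^ n + evalₚ R T x)) length-γ-tail ⟩
    ι 1 * x ^ suc p + (ι a * x ^ p + evalₚ R T x)
      ≈⟨ +-cong (*-congʳ (+-identityʳ 1#)) (+-cong (*-congʳ (ι-mod (1 ℕ.+ z))) T≈x+1) ⟩
    1# * x ^ suc p + (ι (1 ℕ.+ z) * x ^ p + (x + 1#))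
      ≈⟨ trans (+-congʳ (*-identityˡ _)) (sym (+-assoc _ _ _)) ⟩
    x ^ suc p + ι (1 ℕ.+ z) * x ^ p + (x + 1#) ∎
    where
    a = (1 ℕ.+ z) % p
    T = replicate (p ℕ.∸ 2) 0 ++ 1 ∷ 1 ∷ []
    T≈x+1 : evalₚ R T x ≈ x + 1#
    T≈x+1 = begin
      evalₚ R T x
        ≈⟨ trans (evalₚ-zeros-++ (p ℕ.∸ 2) (1 ∷ 1 ∷ []) x) (evalₚ-∷ 1 (1 ∷ []) x) ⟩
      ι 1 * (x * 1#) + evalₚ R (1 ∷ []) x
        ≈⟨ +-cong (*-congʳ (+-identityʳ 1#)) (trans (evalₚ-[ 1 ] x) (+-identityʳ 1#)) ⟩
      1# * (x * 1#) + 1#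
        ≈⟨ +-congʳ (trans (*-identityˡ _) (*-identityʳ x)) ⟩
      x + 1# ∎

  γ-on-𝔽ₚ : ∀ z x → x ^ p ≈ x → evalₚ R (γ p z) x ≈ x * x + ι (2 ℕ.+ z) * x + 1#
  γ-on-𝔽ₚ z x x^p≈x = begin
    evalₚ R (γ p z) x
      ≈⟨ evalₚ-γ z x ⟩
    x * x ^ p + ι (1 ℕ.+ z) * x ^ p + (x + 1#)
      ≈⟨ +-congʳ (+-cong (*-congˡ x^p≈x) (*-congˡ x^p≈x)) ⟩
    x * x + (1# + ι z) * x + (x + 1#)
      ≈⟨ solve 2 (λ x z → x :* x :+ (con (+ 1) :+ z) :* x :+ (x :+ con (+ 1))
                         := x :* x :+ (con (+ 1) :+ (con (+ 1) :+ z)) :* x :+ con (+ 1))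
               refl x (ι z) ⟩
    x * x + ι (2 ℕ.+ z) * x + 1# ∎

module Gamma {c ℓ} (K : CommutativeRing c ℓ) (p : ℕ) .{{_ : NonZero p}} (p-prime : Prime p)
  (char : CommutativeRing._≈_ K (Defs.ι K p) (CommutativeRing.0# K)) (isField : IsField K) where
  open CommutativeRing K
  open IsField isField
  open import Relation.Binary.Reasoning.Setoid setoid
  open import Algebra.Properties.Ring ring using (+-inverseʳ-unique; -0#≈0#)
  open import Algebra.Properties.Semiring.Exp semiring using (_^_)
  open IntegerCoefficients K
  open Polynomials K
  open CharacteristicP K p p-prime char
  open GammaPolynomial K p p-prime char
  open DualNumbers K
  open PrimeField K p p-prime char isField
  open Field K isField
  private
    module Dual-γ = GammaPolynomial Dual p p-prime (dual-char p p-prime char)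
    module ιD = IntegerCoefficients Dual

  derivₚ-γ : ∀ z a → derivₚ (γ p z) a ≈ a ^ p + 1#
  derivₚ-γ z a = begin
    proj₂ (evalₚ Dual (γ p z) X)
      ≈⟨ proj₂ (Dual-γ.evalₚ-γ z X) ⟩
    proj₂ (X ^ᴰ suc p) + (proj₁ A * proj₂ (X ^ᴰ p) + proj₂ A * proj₁ (X ^ᴰ p)) + (1# + 0#)
      ≈⟨ +-cong (+-cong ε[X^[1+p]] (+-cong (*-congˡ ε[X^p]) (*-congʳ (proj₂ (ι-dual (1 ℕ.+ z)))))) (+-identityʳ 1#) ⟩
    a ^ p + (proj₁ A * 0# + 0# * proj₁ (X ^ᴰ p)) + 1#
      ≈⟨ solve 3 (λ x c w → x :+ (c :* con (+ 0) :+ con (+ 0) :* w) :+ con (+ 1) := x :+ con (+ 1))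
               refl (a ^ p) (proj₁ A) (proj₁ (X ^ᴰ p)) ⟩
    a ^ p + 1# ∎
    where
    open import Algebra.Properties.Semiring.Exp (CommutativeRing.semiring Dual) using () renaming (_^_ to _^ᴰ_)
    X = (a , 1#)
    A = ιD.ι (1 ℕ.+ z)
    ε[X^[1+p]] : proj₂ (X ^ᴰ suc p) ≈ a ^ p
    ε[X^[1+p]] = begin
      proj₂ (X ^ᴰ suc p)         ≈⟨ proj₂-^ a 1# (suc p) ⟩
      (1# + ι p) * a ^ p * 1#    ≈⟨ *-congʳ (*-congʳ (+-congˡ char)) ⟩
      (1# + 0#) * a ^ p * 1#     ≈⟨ solve 1 (λ x → (con (+ 1) :+ con (+ 0)) :* x :* con (+ 1) := x) refl (a ^ p) ⟩
      a ^ p                      ∎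
    ε[X^p] : proj₂ (X ^ᴰ p) ≈ 0#
    ε[X^p] = begin
      proj₂ (X ^ᴰ p)             ≈⟨ proj₂-^ a 1# p ⟩
      ι p * a ^ (p ℕ.∸ 1) * 1#   ≈⟨ *-congʳ (*-congʳ char) ⟩
      0# * a ^ (p ℕ.∸ 1) * 1#    ≈⟨ trans (*-congʳ (zeroˡ _)) (zeroˡ 1#) ⟩
      0#                         ∎

  γ-root-relation : ∀ z t → ¬ ι z ≈ 0# → evalₚ K (γ p z) t ≈ 0# →
                    (t ^ p - t) * (t ^ p) ^ p ≈ (t ^ p) ^ p - t ^ p
  γ-root-relation z t ι[z]≉0 γ[t]≈0 = begin
    (u - t) * v
      ≈⟨ solve 3 (λ u t v → (u :- t) :* v := (v :* (u :- t :- con (+ 1)) :+ u) :+ (v :- u)) refl u t v ⟩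
    (v * (u - t - 1#) + u) + (v - u)
      ≈⟨ +-congʳ (x≉0∧xy≈0⇒y≈0 u+A≉0 factored) ⟩
    0# + (v - u)
      ≈⟨ +-identityˡ _ ⟩
    v - u ∎
    where
    A = ι (1 ℕ.+ z)
    u = t ^ p
    v = u ^ p
    γ[t] : t * u + A * u + (t + 1#) ≈ 0#
    γ[t] = trans (sym (evalₚ-γ z t)) γ[t]≈0
    γ[u] : u * v + A * v + (u + 1#) ≈ 0#
    γ[u] = trans (sym (evalₚ-γ z u)) (evalₚ-root-frobenius (γ p z) t γ[t]≈0)
    factored : (u + A) * (v * (u - t - 1#) + u) ≈ 0#
    factored = begin
      (u + A) * (v * (u - t - 1#) + u)
        ≈⟨ solve 4 (λ u a v t → (u :+ a) :* (v :* (u :- t :- con (+ 1)) :+ u)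
                               := (t :* u :+ a :* u :+ (t :+ con (+ 1)))
                                  :+ (u :- t :- con (+ 1)) :* (u :* v :+ a :* v :+ (u :+ con (+ 1))))
                 refl u A v t ⟩
      (t * u + A * u + (t + 1#)) + (u - t - 1#) * (u * v + A * v + (u + 1#))
        ≈⟨ +-cong γ[t] (trans (*-congˡ γ[u]) (zeroʳ _)) ⟩
      0# + 0#
        ≈⟨ +-identityʳ 0# ⟩
      0# ∎
    u+A≉0 : ¬ u + A ≈ 0#
    u+A≉0 u+A≈0 = ι[z]≉0 (begin
      ι z
        ≈⟨ solve 3 (λ z u v → z := (u :+ (con (+ 1) :+ z))
                                   :- (u :* v :+ (con (+ 1) :+ z) :* v :+ (u :+ con (+ 1)) :- v :* (u :+ (con (+ 1) :+ z))))
                 refl (ι z) u v ⟩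
      (u + A) - (u * v + A * v + (u + 1#) - v * (u + A))
        ≈⟨ +-cong u+A≈0 (-‿cong (+-cong γ[u] (-‿cong (trans (*-congˡ u+A≈0) (zeroʳ v))))) ⟩
      0# - (0# - 0#)
        ≈⟨ trans (+-congˡ (-‿cong (-‿inverseʳ 0#))) (-‿inverseʳ 0#) ⟩
      0# ∎)

  γ-root-identity : ∀ z t → ¬ ι z ≈ 0# → evalₚ K (γ p z) t ≈ 0# → ¬ t ^ p ≈ t →
                    (t ^ p - t) ^ (p ℕ.∸ 1) ≈ t ^ (p ℕ.^ 2)
  γ-root-identity z t ι[z]≉0 γ[t]≈0 t^p≉t = begin
    (t ^ p - t) ^ (p ℕ.∸ 1)   ≈⟨ *-cancelˡ (x≉y⇒x-y≉0 t^p≉t) (begin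
      (t ^ p - t) * (t ^ p - t) ^ (p ℕ.∸ 1)  ≈⟨ x*x^[n∸1]≈x^n (t ^ p - t) p ⟩
      (t ^ p - t) ^ p                         ≈⟨ frobenius-- (t ^ p) t ⟩
      (t ^ p) ^ p - t ^ p                     ≈⟨ γ-root-relation z t ι[z]≉0 γ[t]≈0 ⟨
      (t ^ p - t) * (t ^ p) ^ p               ∎) ⟩
    (t ^ p) ^ p               ≈⟨ ^p²≈^p^p t ⟨
    t ^ (p ℕ.^ 2)             ∎
    where
    x*x^[n∸1]≈x^n : ∀ x n .{{_ : NonZero n}} → x * x ^ (n ℕ.∸ 1) ≈ x ^ n
    x*x^[n∸1]≈x^n x (suc n) = refl

  γ-double-root : ∀ z ds t → All (p ∣_) (remMonic p ds (γ p z)) →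
    evalₚ K (quotMonic p ds (γ p z)) t ≈ 0# → evalMonicₚ ds t ≈ 0# → t ^ p ≈ t → t ≈ - 1#
  γ-double-root z ds t rem≡0 q[t]≈0 m[t]≈0 t^p≈t = +-inverseʳ-unique 1# t (begin
    1# + t               ≈⟨ +-comm 1# t ⟩
    t + 1#               ≈⟨ +-congʳ t^p≈t ⟨
    t ^ p + 1#           ≈⟨ derivₚ-γ z t ⟨
    derivₚ (γ p z) t     ≈⟨ derivₚ-double-root p p-prime char ds (γ p z) t rem≡0 q[t]≈0 m[t]≈0 ⟩
    0#                   ∎)

  quadratic-root : ∀ S V h → V * V ≈ S * S - fromℕ 4 → fromℕ 2 * h ≈ 1# →
                   ((V - S) * h) * ((V - S) * h) + S * ((V - S) * h) + 1# ≈ 0#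
  quadratic-root S V h V²≈S²-4 2h≈1 = begin
    ((V - S) * h) * ((V - S) * h) + S * ((V - S) * h) + 1#
      ≈⟨ solve 3 (λ S V h → ((V :- S) :* h) :* ((V :- S) :* h) :+ S :* ((V :- S) :* h) :+ con (+ 1)
                           := h :* h :* (V :* V :- (S :* S :- con (+ 4)))
                              :+ (con (+ 2) :* h :- con (+ 1)) :* (h :* S :* S :- con (+ 2) :* h :- con (+ 1) :- h :* V :* S))
               refl S V h ⟩
    h * h * (V * V - (S * S - fromℕ 4)) + (fromℕ 2 * h - 1#) * (h * S * S - fromℕ 2 * h - 1# - h * V * S)
      ≈⟨ +-cong (*-congˡ (x≈y⇒x-y≈0 V²≈S²-4)) (*-congʳ (x≈y⇒x-y≈0 2h≈1)) ⟩
    h * h * 0# + 0# * (h * S * S - fromℕ 2 * h - 1# - h * V * S)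
      ≈⟨ trans (+-cong (zeroʳ _) (zeroˡ _)) (+-identityʳ 0#) ⟩
    0# ∎
    where
    x≈y⇒x-y≈0 : ∀ {x y} → x ≈ y → x - y ≈ 0#
    x≈y⇒x-y≈0 {x} {y} x≈y = trans (+-congʳ x≈y) (-‿inverseʳ y)

  discriminant : ∀ z → ι (2 ℕ.+ z) * ι (2 ℕ.+ z) - fromℕ 4 ≈ ι (z ℕ.* z ℕ.+ 4 ℕ.* z)
  discriminant z = begin
    ι (2 ℕ.+ z) * ι (2 ℕ.+ z) - fromℕ 4
      ≈⟨ solve 1 (λ Z → (con (+ 1) :+ (con (+ 1) :+ Z)) :* (con (+ 1) :+ (con (+ 1) :+ Z)) :- con (+ 4)
                       := Z :* Z :+ con (+ 4) :* Z)
               refl (ι z) ⟩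
    ι z * ι z + fromℕ 4 * ι z
      ≈⟨ +-cong (ι-* z z) (trans (ι-* 4 z) (*-congʳ (sym (fromℕ≈ι 4)))) ⟨
    ι (z ℕ.* z) + ι (4 ℕ.* z)
      ≈⟨ ι-+ (z ℕ.* z) (4 ℕ.* z) ⟨
    ι (z ℕ.* z ℕ.+ 4 ℕ.* z) ∎

  evalMonicₚ-quadratic : ∀ z x → evalMonicₚ (((z ℕ.+ 2) % p) ∷ 1 ∷ []) x ≈ x * x + ι (2 ℕ.+ z) * x + 1#
  evalMonicₚ-quadratic z x = begin
    x * (x * 1#) + evalₚ K (((z ℕ.+ 2) % p) ∷ 1 ∷ []) x
      ≈⟨ +-cong (*-congˡ (*-identityʳ x)) (evalₚ-∷ ((z ℕ.+ 2) % p) (1 ∷ []) x) ⟩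
    x * x + (ι ((z ℕ.+ 2) % p) * (x * 1#) + evalₚ K (1 ∷ []) x)
      ≈⟨ +-congˡ (+-cong (*-cong S≈ (*-identityʳ x)) (trans (evalₚ-[ 1 ] x) (+-identityʳ 1#))) ⟩
    x * x + (ι (2 ℕ.+ z) * x + 1#)
      ≈⟨ +-assoc _ _ _ ⟨
    x * x + ι (2 ℕ.+ z) * x + 1# ∎
    where
    S≈ : ι ((z ℕ.+ 2) % p) ≈ ι (2 ℕ.+ z)
    S≈ = trans (ι-mod (z ℕ.+ 2)) (reflexive (≡.cong ι (ℕₚ.+-comm z 2)))

  γ-root-non-square : ∀ z t → ¬ IsSquareₚ p (z ℕ.* z ℕ.+ 4 ℕ.* z) →
                      evalₚ K (γ p z) t ≈ 0# → ¬ t ^ p ≈ t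
  γ-root-non-square z t non-square γ[t]≈0 t^p≈t = ∉𝔽ₚ⇒^p≉id w w∉𝔽ₚ w-fixed
    where
    S = ι (2 ℕ.+ z)
    w = fromℕ 2 * t + S
    w-fixed : w ^ p ≈ w
    w-fixed = trans (frobenius-+ (fromℕ 2 * t) S)
      (+-cong (trans (frobenius-* (fromℕ 2) t) (*-cong (frobenius-fromℕ 2) t^p≈t)) (frobenius-ι (2 ℕ.+ z)))
    w² : w * w ≈ ι (z ℕ.* z ℕ.+ 4 ℕ.* z)
    w² = begin
      w * w
        ≈⟨ solve 2 (λ t S → (con (+ 2) :* t :+ S) :* (con (+ 2) :* t :+ S)
                           := con (+ 4) :* (t :* t :+ S :* t :+ con (+ 1)) :+ (S :* S :- con (+ 4)))
                 refl t S ⟩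
      fromℕ 4 * (t * t + S * t + 1#) + (S * S - fromℕ 4)
        ≈⟨ +-cong (*-congˡ (trans (sym (γ-on-𝔽ₚ z t t^p≈t)) γ[t]≈0)) (discriminant z) ⟩
      fromℕ 4 * 0# + ι (z ℕ.* z ℕ.+ 4 ℕ.* z)
        ≈⟨ trans (+-congʳ (zeroʳ _)) (+-identityˡ _) ⟩
      ι (z ℕ.* z ℕ.+ 4 ℕ.* z) ∎
    w∉𝔽ₚ : ∀ i → i < p → ¬ w ≈ ι i
    w∉𝔽ₚ i i<p w≈ι[i] = non-square (lose (∈-upTo⁺ i<p) (ι-injective-mod (begin
      ι (i ℕ.* i)               ≈⟨ ι-* i i ⟩
      ι i * ι i                 ≈⟨ *-cong w≈ι[i] w≈ι[i] ⟨
      w * w                     ≈⟨ w² ⟩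
      ι (z ℕ.* z ℕ.+ 4 ℕ.* z)   ∎)))

  module _ (p≢2 : ¬ p ≡ 2) where

    γbar-root-divisor-X-1 : ∀ z t → (z ℕ.+ 4) % p ≡ 0 →
      evalₚ K (quotMonic p ((p ℕ.∸ 1) ∷ []) (γ p z)) t ≈ 0# → evalₚ K (γ p z) t ≈ 0# × ¬ t ^ p ≈ t
    γbar-root-divisor-X-1 z t z+4≡0 q[t]≈0 = γ[t]≈0 , t^p≉t
      where
      ds = (p ℕ.∸ 1) ∷ []
      X-1 : ∀ x → evalMonicₚ ds x ≈ x - 1#
      X-1 x = +-cong (*-identityʳ x)
        (trans (evalₚ-[ p ℕ.∸ 1 ] x) (trans (ι-∸ (ℕ.>-nonZero⁻¹ p)) (-‿cong (+-identityʳ 1#))))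
      z+4≈0 : ι z + fromℕ 4 ≈ 0#
      z+4≈0 = begin
        ι z + fromℕ 4     ≈⟨ +-congˡ (fromℕ≈ι 4) ⟩
        ι z + ι 4         ≈⟨ ι-+ z 4 ⟨
        ι (z ℕ.+ 4)       ≈⟨ ι-mod (z ℕ.+ 4) ⟨
        ι ((z ℕ.+ 4) % p) ≡⟨ ≡.cong ι z+4≡0 ⟩
        0#                ∎
      γ[1]≈0 : evalₚ K (γ p z) 1# ≈ 0#
      γ[1]≈0 = begin
        evalₚ K (γ p z) 1#
          ≈⟨ evalₚ-γ z 1# ⟩
        1# * 1# ^ p + (1# + ι z) * 1# ^ p + (1# + 1#)
          ≈⟨ +-congʳ (+-cong (*-congˡ frobenius-1) (*-congˡ frobenius-1)) ⟩
        1# * 1# + (1# + ι z) * 1# + (1# + 1#)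
          ≈⟨ solve 1 (λ z → con (+ 1) :* con (+ 1) :+ (con (+ 1) :+ z) :* con (+ 1) :+ (con (+ 1) :+ con (+ 1))
                           := z :+ con (+ 4))
                   refl (ι z) ⟩
        ι z + fromℕ 4
          ≈⟨ z+4≈0 ⟩
        0# ∎
      rem≡0 : All (p ∣_) (remMonic p ds (γ p z))
      rem≡0 = vanishing-constant⇒p∣ _ 1# (length-remMonic ds (γ p z))
                (evalₚ-remMonic-common-root ds (γ p z) 1# (trans (X-1 1#) (-‿inverseʳ 1#)) γ[1]≈0)
      γ[t]≈0 = evalₚ-quotient-root ds (γ p z) t rem≡0 q[t]≈0
      t^p≉t : ¬ t ^ p ≈ t
      t^p≉t t^p≈t = t-1≉0 (x≉0∧xy≈0⇒y≈0 t-1≉0 (begin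
        (t - 1#) * (t - 1#)
          ≈⟨ solve 2 (λ t z → (t :- con (+ 1)) :* (t :- con (+ 1))
                             := (t :* t :+ (con (+ 1) :+ (con (+ 1) :+ z)) :* t :+ con (+ 1)) :- (z :+ con (+ 4)) :* t)
                   refl t (ι z) ⟩
        (t * t + ι (2 ℕ.+ z) * t + 1#) - (ι z + fromℕ 4) * t
          ≈⟨ +-cong (trans (sym (γ-on-𝔽ₚ z t t^p≈t)) γ[t]≈0) (-‿cong (trans (*-congʳ z+4≈0) (zeroˡ t))) ⟩
        0# - 0#
          ≈⟨ -‿inverseʳ 0# ⟩
        0# ∎))
        where
        t-1≉0 : ¬ t - 1# ≈ 0#
        t-1≉0 t-1≈0 = ι2≉0 p≢2 (begin
          1# + (1# + 0#)
            ≈⟨ solve 1 (λ t → con (+ 1) :+ (con (+ 1) :+ con (+ 0)) := (t :+ con (+ 1)) :- (t :- con (+ 1))) refl t ⟩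
          (t + 1#) - (t - 1#)
            ≈⟨ +-cong (trans (+-congʳ t≈-1) (-‿inverseˡ 1#)) (-‿cong t-1≈0) ⟩
          0# - 0#
            ≈⟨ -‿inverseʳ 0# ⟩
          0# ∎)
          where t≈-1 = γ-double-root z ds t rem≡0 q[t]≈0 (trans (X-1 t) t-1≈0) t^p≈t

    quadratic-divisor-remainder : ∀ z → ¬ ι z ≈ 0# → ¬ (z ℕ.+ 4) % p ≡ 0 →
      IsSquareₚ p (z ℕ.* z ℕ.+ 4 ℕ.* z) → All (p ∣_) (remMonic p (((z ℕ.+ 2) % p) ∷ 1 ∷ []) (γ p z))
    quadratic-divisor-remainder z ι[z]≉0 z+4≢0 square with satisfied square
    ... | w , w²≡ = vanishing-linear⇒p∣ _ r₊ r₋ (length-remMonic ds (γ p z)) r₊≉r₋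
                      (rem-root W W-fixed W²) (rem-root (- W) -W-fixed -W²)
      where
      ds = ((z ℕ.+ 2) % p) ∷ 1 ∷ []
      S = ι (2 ℕ.+ z)
      W = ι w
      W² : W * W ≈ S * S - fromℕ 4
      W² = begin
        W * W                         ≈⟨ ι-* w w ⟨
        ι (w ℕ.* w)                   ≈⟨ ι-mod (w ℕ.* w) ⟨
        ι ((w ℕ.* w) % p)             ≡⟨ ≡.cong ι w²≡ ⟩
        ι ((z ℕ.* z ℕ.+ 4 ℕ.* z) % p) ≈⟨ ι-mod _ ⟩
        ι (z ℕ.* z ℕ.+ 4 ℕ.* z)       ≈⟨ discriminant z ⟨
        S * S - fromℕ 4               ∎
      -W² : - W * - W ≈ S * S - fromℕ 4
      -W² = trans (solve 1 (λ w → :- w :* :- w := w :* w) refl W) W²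
      W-fixed : W ^ p ≈ W
      W-fixed = frobenius-ι w
      -W-fixed : (- W) ^ p ≈ - W
      -W-fixed = trans (frobenius-neg W) (-‿cong W-fixed)
      2≉0 : ¬ fromℕ 2 ≈ 0#
      2≉0 2≈0 = ι2≉0 p≢2 (trans (sym (fromℕ≈ι 2)) 2≈0)
      h = proj₁ (inverse (fromℕ 2) 2≉0)
      2h≈1 : fromℕ 2 * h ≈ 1#
      2h≈1 = proj₂ (inverse (fromℕ 2) 2≉0)
      h-fixed : h ^ p ≈ h
      h-fixed = frobenius-fixes-inverse 2≉0 (frobenius-fromℕ 2) 2h≈1
      rem-root : ∀ V → V ^ p ≈ V → V * V ≈ S * S - fromℕ 4 →
                 evalₚ K (remMonic p ds (γ p z)) ((V - S) * h) ≈ 0#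
      rem-root V V-fixed V² = evalₚ-remMonic-common-root ds (γ p z) r
          (trans (evalMonicₚ-quadratic z r) Q[r]≈0) (trans (γ-on-𝔽ₚ z r r-fixed) Q[r]≈0)
        where
        r = (V - S) * h
        Q[r]≈0 = quadratic-root S V h V² 2h≈1
        r-fixed : r ^ p ≈ r
        r-fixed = trans (frobenius-* (V - S) h)
          (*-cong (trans (frobenius-- V S) (+-cong V-fixed (-‿cong (frobenius-ι (2 ℕ.+ z))))) h-fixed)
      r₊ = (W - S) * h
      r₋ = (- W - S) * h
      W≉0 : ¬ W ≈ 0#
      W≉0 W≈0 = z+4≢0 (ι≈0⇒%≡0 (x≉0∧xy≈0⇒y≈0 ι[z]≉0 (begin
        ι z * ι (z ℕ.+ 4)
          ≈⟨ ι-* z (z ℕ.+ 4) ⟨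
        ι (z ℕ.* (z ℕ.+ 4))
          ≡⟨ ≡.cong ι (≡.trans (ℕₚ.*-distribˡ-+ z z 4) (≡.cong (z ℕ.* z ℕ.+_) (ℕₚ.*-comm z 4))) ⟩
        ι (z ℕ.* z ℕ.+ 4 ℕ.* z)
          ≈⟨ trans (sym (discriminant z)) (sym W²) ⟩
        W * W
          ≈⟨ trans (*-congʳ W≈0) (zeroˡ W) ⟩
        0# ∎)))
      r₊≉r₋ : ¬ r₊ ≈ r₋
      r₊≉r₋ r₊≈r₋ = W≉0 (begin
        W
          ≈⟨ solve 3 (λ W S h → W := W :* (con (+ 1) :- con (+ 2) :* h) :+ ((W :- S) :* h :- (:- W :- S) :* h))
                   refl W S h ⟩
        W * (1# - fromℕ 2 * h) + (r₊ - r₋)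
          ≈⟨ +-cong (trans (*-congˡ (trans (+-congˡ (-‿cong 2h≈1)) (-‿inverseʳ 1#))) (zeroʳ W))
                    (trans (+-congʳ r₊≈r₋) (-‿inverseʳ r₋)) ⟩
        0# + 0#
          ≈⟨ +-identityʳ 0# ⟩
        0# ∎)

    γbar-root-quadratic-divisor : ∀ z t → ¬ ι z ≈ 0# → ¬ (z ℕ.+ 4) % p ≡ 0 → IsSquareₚ p (z ℕ.* z ℕ.+ 4 ℕ.* z) →
      evalₚ K (quotMonic p (((z ℕ.+ 2) % p) ∷ 1 ∷ []) (γ p z)) t ≈ 0# →
      evalₚ K (γ p z) t ≈ 0# × ¬ t ^ p ≈ t
    γbar-root-quadratic-divisor z t ι[z]≉0 z+4≢0 square q[t]≈0 = γ[t]≈0 , t^p≉t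
      where
      ds = ((z ℕ.+ 2) % p) ∷ 1 ∷ []
      rem≡0 = quadratic-divisor-remainder z ι[z]≉0 z+4≢0 square
      γ[t]≈0 = evalₚ-quotient-root ds (γ p z) t rem≡0 q[t]≈0
      t^p≉t : ¬ t ^ p ≈ t
      t^p≉t t^p≈t = ι[z]≉0 (begin
        ι z
          ≈⟨ solve 1 (λ z → z := :- ((:- con (+ 1)) :* (:- con (+ 1))
                                      :+ (con (+ 1) :+ (con (+ 1) :+ z)) :* (:- con (+ 1)) :+ con (+ 1)))
                   refl (ι z) ⟩
        - ((- 1#) * (- 1#) + ι (2 ℕ.+ z) * (- 1#) + 1#)
          ≈⟨ -‿cong (+-congʳ (+-cong (*-cong t≈-1 t≈-1) (*-congˡ t≈-1))) ⟨
        - (t * t + ι (2 ℕ.+ z) * t + 1#)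
          ≈⟨ trans (-‿cong Q[t]≈0) -0#≈0# ⟩
        0# ∎)
        where
        Q[t]≈0 = trans (sym (γ-on-𝔽ₚ z t t^p≈t)) γ[t]≈0
        t≈-1 = γ-double-root z ds t rem≡0 q[t]≈0 (trans (evalMonicₚ-quadratic z t) Q[t]≈0) t^p≈t

    γbar-root : ∀ z t → evalₚ K (γbar p z) t ≈ 0# → ¬ ι z ≈ 0# × evalₚ K (γ p z) t ≈ 0# × ¬ t ^ p ≈ t
    γbar-root z t γbar[t]≈0 with (z % p) ℕ.≟ 0
    ... | yes _   = ⊥-elim (1≉0 (trans (sym (trans (evalₚ-[ 1 ] t) (+-identityʳ 1#))) γbar[t]≈0))
    ... | no z≢0 with ((z ℕ.+ 4) % p) ℕ.≟ 0
    ...   | yes z+4≡0 = %≢0⇒ι≉0 z≢0 , γbar-root-divisor-X-1 z t z+4≡0 γbar[t]≈0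
    ...   | no z+4≢0 with isSquareₚ? p (z ℕ.* z ℕ.+ 4 ℕ.* z)
    ...     | yes square     = %≢0⇒ι≉0 z≢0 , γbar-root-quadratic-divisor z t (%≢0⇒ι≉0 z≢0) z+4≢0 square γbar[t]≈0
    ...     | no  non-square = %≢0⇒ι≉0 z≢0 , γbar[t]≈0 , γ-root-non-square z t non-square γbar[t]≈0

algebraicClosure⇒isField : ∀ {c ℓ} {K : CommutativeRing c ℓ} {p} → IsAlgClosureOfFₚ K p → IsField K
algebraicClosure⇒isField closure = record { 1≉0 = nontrivial ; inverse = inverses }
  where open IsAlgClosureOfFₚ closure

-- Opened only here: unqualified, ℕ's _^_ would clash with the ring's _^_ above.
open import Data.Nat using (_^_)

theorem9p2 : {c ℓ : Level} (K : CommutativeRing c ℓ) (p : ℕ) .{{_ : NonZero p}} →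
    Prime p → ¬ (p ≡ 2) → IsAlgClosureOfFₚ K p →
    (z : ℕ) → z < p → (t : CommutativeRing.Carrier K) →
    CommutativeRing._≈_ K (evalₚ K (γbar p z) t) (CommutativeRing.0# K) →
    let open CommutativeRing K
        open RS (Semiring.rawSemiring semiring) using () renaming (_^_ to _^ᴷ_)
        s = ((t ^ᴷ p) - t) ^ᴷ (p ∸ 1)
    in (s ≈ t ^ᴷ (p ^ 2)) × (evalₚ K (γbar p z) s ≈ 0#)
theorem9p2 K p p-prime p≢2 closure z _ t γbar[t]≈0 =
  let ι[z]≉0 , γ[t]≈0 , t^p≉t = γbar-root p≢2 z t γbar[t]≈0
      s≈t^p² = γ-root-identity z t ι[z]≉0 γ[t]≈0 t^p≉t
      γbar[t^p^p]≈0 = evalₚ-root-frobenius (γbar p z) _ (evalₚ-root-frobenius (γbar p z) t γbar[t]≈0)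
  in s≈t^p² , trans (evalₚ-cong (γbar p z) (trans s≈t^p² (^p²≈^p^p t))) γbar[t^p^p]≈0
  where
  open CommutativeRing K
  open IsAlgClosureOfFₚ closure
  open Polynomials K using (evalₚ-cong)
  open CharacteristicP K p p-prime characteristic using (evalₚ-root-frobenius; ^p²≈^p^p)
  open Gamma K p p-prime characteristic (algebraicClosure⇒isField closure) using (γbar-root; γ-root-identity)
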